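{- For every integer $N\ge0$: (1) $p_2(16N+10)=\frac12\sum_{d\mid 16N+10}\chi_4(d)$; (2) $p_2(12N+5)=\frac12\sum_{d\mid 12N+5}\chi_4(d)$; (3) if $N$ is odd, $p_3(8N+6)=\frac1{48}r_3(8N+6)$.
   Context: $p_k(n)$ is the number of partitions of $n$ into $k$ squares, i.e. the number of ways to write $n$ as a sum of $k$ squares of nonnegative integers, disregarding order. $r_3(n)$ is the number of $(x,y,z)\in\mathbb{Z}^3$ with $x^2+y^2+z^2=n$. The sums run over positive divisors $d$. $\chi_4(d)=1$ if $d\equiv1\pmod4$, $-1$ if $d\equiv-1\pmod4$, and $0$ if $d$ is even. -}

module Defs where

open import Data.Nat as ℕ using (ℕ; zero; suc; _+_; _*_; _∸_; _≤?_; _≟_)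
open import Data.Nat.Divisibility using (_∣?_)
open import Data.Integer as ℤ using (ℤ; +_; -_)
open import Data.List using (List; []; _∷_; length; filter; map; upTo; concatMap; sum)
open import Data.Product using (_×_; _,_)
open import Relation.Nullary.Decidable using (does)
open import Data.Bool using (if_then_else_)

-- Listing each a-multiset once as a sorted sequence
-- is the standard way of "disregarding order".
-- All entries satisfy a ≤ a² ≤ n, so it suffices to range over 0..n.
sortedSquareReps : ℕ → ℕ → ℕ → List (List ℕ)
sortedSquareReps zero    lo n = if does (n ≟ 0) then ([] ∷ []) else []
sortedSquareReps (suc k) lo n =
  concatMap (λ a → map (a ∷_) (sortedSquareReps k a (n ∸ a * a)))
            (filter (λ a → lo ≤? a) (filter (λ a → a * a ≤? n) (upTo (suc n))))

p : ℕ → ℕ → ℕ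
p k n = length (sortedSquareReps k 0 n)

intRange : ℕ → List ℤ
intRange n = map (λ i → + i) (upTo (suc n)) Data.List.++ map (λ i → - (+ suc i)) (upTo n)

-- r₃ n : number of (x,y,z) ∈ ℤ³ with x²+y²+z² = n. (Every solution has
-- |x|,|y|,|z| ≤ n, so ranging over -n..n is exhaustive.)
r₃ : ℕ → ℕ
r₃ n = length (filter (λ t → sq t ℤ.≟ + n) triples)
  where
  triples : List (ℤ × ℤ × ℤ)
  triples = concatMap (λ x → concatMap (λ y → map (λ z → x , y , z) (intRange n)) (intRange n)) (intRange n)
  sq : ℤ × ℤ × ℤ → ℤ
  sq (x , y , z) = x ℤ.* x ℤ.+ y ℤ.* y ℤ.+ z ℤ.* z

χ₄ : ℕ → ℤ
χ₄ d with d ℕ.% 4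
... | 1 = + 1
... | 3 = - (+ 1)
... | _ = + 0

divisorSumχ₄ : ℕ → ℤ
divisorSumχ₄ m = Data.List.foldr ℤ._+_ (+ 0)
  (map χ₄ (filter (λ d → d ∣? m) (map suc (upTo m))))

module Submission where

-- Jacobi's formula r₂(n) = 4 Σ_{d ∣ n} χ₄(d) is proved by induction over the prime factors of n, reading points
-- of ℤ² as Gaussian integers. Multiplying by 1 + i shows r₂(2m) = r₂(m). For p ≡ 1 (mod 4), Fermat's theorem
-- (via Zagier's involution) gives p = a² + b², and a point of norm p m is a multiple of a + b i or of a − b i,
-- of both exactly when it is p times a point; so r₂(p m) = 2 r₂(m) − r₂(m / p). For p ≡ 3 (mod 4), −1 is not
-- a square mod p, so p divides both coordinates and r₂(p m) = r₂(m / p). (Here r₂(m / p) = 0 when p ∤ m.)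
-- The divisor sum obeys the same recursions because χ₄ is completely multiplicative.
--
-- For n = 16N + 10, 12N + 5 (resp. 8N + 6 with N odd) residues mod 16 and 12 rule out representations with a
-- zero or a repeated square, so each sorted representation gives 8 (resp. 48) signed ordered ones: r₂ = 8 p₂
-- and r₃ = 48 p₃.

module FiniteChecks where

  open import Data.Nat using (ℕ; _<_)
  open import Data.List using (upTo)
  open import Data.List.Membership.Propositional.Properties using (∈-upTo⁺)
  open import Data.List.Relation.Unary.All as All using (all?)
  open import Relation.Nullary.Decidable using (True; toWitness)
  open import Relation.Binary.Definitions using () renaming (Decidable to Decidable₂)

  ∀<²-by-decision : ∀ {R : ℕ → ℕ → Set} (R? : Decidable₂ R) m →
                    True (all? (λ i → all? (R? i) (upTo m)) (upTo m)) → ∀ {i j} → i < m → j < m → R i j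
  ∀<²-by-decision R? m checked i<m j<m = All.lookup (All.lookup (toWitness checked) (∈-upTo⁺ i<m)) (∈-upTo⁺ j<m)

module Counting where

  open import Data.Nat using (ℕ; suc; _+_; _*_; _≤_; s≤s)
  open import Data.Nat.Properties using (≤-refl; ≤-trans; n≤1+n; +-suc; *-suc; *-zeroʳ)
  open import Data.List using (List; []; _∷_; length; filter; map; concatMap; _++_)
  open import Data.List.Properties using (length-map; length-++; filter-all; filter-accept; filter-reject)
  open import Data.List.Membership.Propositional using (_∈_)
  open import Data.List.Membership.Propositional.Properties using (∈-filter⁺; ∈-filter⁻; ∈-map⁺; ∈-map⁻; ∈-concatMap⁻)
  open import Data.List.Membership.Propositional.Properties.WithK using (unique∧set⇒bag)
  open import Data.List.Relation.Unary.All as All using (All; []; _∷_)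
  open import Data.List.Relation.Unary.Any using (Any; here; there)
  open import Data.List.Relation.Unary.AllPairs using ([]; _∷_)
  open import Data.List.Relation.Unary.Unique.Propositional using (Unique)
  import Data.List.Relation.Unary.Unique.Propositional.Properties as Unique
  open import Data.List.Relation.Binary.BagAndSetEquality using (∼bag⇒↭)
  open import Data.List.Relation.Binary.Permutation.Propositional using (_↭_)
  open import Data.List.Relation.Binary.Permutation.Propositional.Properties using (↭-length)
  open import Data.Product using (_×_; _,_; ∃; proj₁; proj₂)
  open import Data.Empty using (⊥; ⊥-elim)
  open import Function.Bundles using (_⇔_; mk⇔; Equivalence)
  open import Function.Base using (_∘_)
  open import Level using (0ℓ)
  open import Relation.Nullary using (¬_; yes; no; ¬?)
  open import Relation.Unary using (Pred; Decidable)
  open import Relation.Unary.Properties using (∁?)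
  open import Relation.Binary.Definitions using (DecidableEquality)
  open import Relation.Binary.PropositionalEquality using (_≡_; _≢_; refl; sym; trans; cong; cong₂; subst; module ≡-Reasoning)

  private
    variable
      A B : Set

  unique-⇔⇒↭ : {xs ys : List A} → Unique xs → Unique ys → (∀ {z} → z ∈ xs ⇔ z ∈ ys) → xs ↭ ys
  unique-⇔⇒↭ xs! ys! xs⇔ys = ∼bag⇒↭ (unique∧set⇒bag xs! ys! xs⇔ys)

  length-unique-⇔ : {xs ys : List A} → Unique xs → Unique ys → (∀ {z} → z ∈ xs ⇔ z ∈ ys) → length xs ≡ length ys
  length-unique-⇔ xs! ys! xs⇔ys = ↭-length (unique-⇔⇒↭ xs! ys! xs⇔ys)

  map-unique : (f : A → B) {xs : List A} → (∀ {a b} → a ∈ xs → b ∈ xs → f a ≡ f b → a ≡ b) →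
               Unique xs → Unique (map f xs)
  map-unique f {[]} _ [] = []
  map-unique f {x ∷ xs} f-inj (x∉xs ∷ xs!) =
    images-differ x∉xs (λ b∈ → b∈) ∷ map-unique f (λ a∈ b∈ → f-inj (there a∈) (there b∈)) xs!
    where
    images-differ : ∀ {ys} → All (x ≢_) ys → (∀ {b} → b ∈ ys → b ∈ xs) → All (f x ≢_) (map f ys)
    images-differ [] _ = []
    images-differ (x≢y ∷ x≢ys) ys⊆xs =
      (λ fx≡fy → x≢y (f-inj (here refl) (there (ys⊆xs (here refl))) fx≡fy)) ∷ images-differ x≢ys (λ b∈ → ys⊆xs (there b∈))

  concatMap-unique : (f : A → List B) (label : B → A) {xs : List A} → Unique xs →
                     (∀ {a} → a ∈ xs → Unique (f a)) → (∀ {a b} → a ∈ xs → b ∈ f a → label b ≡ a) →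
                     Unique (concatMap f xs)
  concatMap-unique f label {[]} _ _ _ = []
  concatMap-unique f label {x ∷ xs} (x∉xs ∷ xs!) f! labelled =
    Unique.++⁺ (f! (here refl)) (concatMap-unique f label xs! (λ a∈ → f! (there a∈)) (λ a∈ → labelled (there a∈))) disjoint
    where
    disjoint : ∀ {b} → ¬ (b ∈ f x × b ∈ concatMap f xs)
    disjoint {b} (b∈fx , b∈rest) = not-later x∉xs (λ a∈ → there a∈) (∈-concatMap⁻ f {xs = xs} b∈rest)
      where
      not-later : ∀ {ys} → All (x ≢_) ys → (∀ {a} → a ∈ ys → a ∈ x ∷ xs) → Any (λ a → b ∈ f a) ys → ⊥
      not-later (x≢y ∷ _) ys⊆ (here b∈fy) = x≢y (trans (sym (labelled (here refl) b∈fx)) (labelled (ys⊆ (here refl)) b∈fy))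
      not-later (_ ∷ x≢ys) ys⊆ (there b∈) = not-later x≢ys (λ a∈ → ys⊆ (there a∈)) b∈

  length-concatMap : (k : ℕ) (f : A → List B) (xs : List A) → (∀ {a} → a ∈ xs → length (f a) ≡ k) →
                     length (concatMap f xs) ≡ k * length xs
  length-concatMap k f [] _ = sym (*-zeroʳ k)
  length-concatMap k f (x ∷ xs) len-f = begin
    length (f x ++ concatMap f xs)           ≡⟨ length-++ (f x) ⟩
    length (f x) + length (concatMap f xs)   ≡⟨ cong₂ _+_ (len-f (here refl)) (length-concatMap k f xs (λ a∈ → len-f (there a∈))) ⟩
    k + k * length xs                        ≡⟨ sym (*-suc k (length xs)) ⟩
    k * suc (length xs)                      ∎
    where open ≡-Reasoning

  module _ {P : Pred A 0ℓ} {Q : Pred B 0ℓ} (P? : Decidable P) (Q? : Decidable Q) where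

    length-filter-bijection : {xs : List A} {ys : List B} → Unique xs → Unique ys → (f : A → B) →
      (∀ {a} → a ∈ xs → P a → f a ∈ ys × Q (f a)) →
      (∀ {a b} → a ∈ xs → P a → b ∈ xs → P b → f a ≡ f b → a ≡ b) →
      (∀ {b} → b ∈ ys → Q b → ∃ λ a → a ∈ xs × P a × f a ≡ b) →
      length (filter P? xs) ≡ length (filter Q? ys)
    length-filter-bijection {xs} {ys} xs! ys! f into injective onto = begin
      length (filter P? xs)           ≡⟨ sym (length-map f (filter P? xs)) ⟩
      length (map f (filter P? xs))   ≡⟨ length-unique-⇔ image! (Unique.filter⁺ Q? ys!) (mk⇔ image⊆ ⊆image) ⟩
      length (filter Q? ys)           ∎
      where
      open ≡-Reasoning
      image! : Unique (map f (filter P? xs))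
      image! = map-unique f (λ a∈ b∈ → let (a∈xs , pa) = ∈-filter⁻ P? a∈ ; (b∈xs , pb) = ∈-filter⁻ P? b∈ in
                                        injective a∈xs pa b∈xs pb)
                            (Unique.filter⁺ P? xs!)
      image⊆ : ∀ {b} → b ∈ map f (filter P? xs) → b ∈ filter Q? ys
      image⊆ b∈ with ∈-map⁻ f b∈
      ... | a , a∈ , refl = let (a∈xs , pa) = ∈-filter⁻ P? a∈ ; (fa∈ys , qfa) = into a∈xs pa in ∈-filter⁺ Q? fa∈ys qfa
      ⊆image : ∀ {b} → b ∈ filter Q? ys → b ∈ map f (filter P? xs)
      ⊆image b∈ with ∈-filter⁻ Q? b∈
      ... | b∈ys , qb with onto b∈ys qb
      ... | a , a∈xs , pa , refl = ∈-map⁺ f (∈-filter⁺ P? a∈xs pa)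

  module _ {P : Pred A 0ℓ} (P? : Decidable P) where

    length-filter-∁-split : ∀ xs → length xs ≡ length (filter P? xs) + length (filter (∁? P?) xs)
    length-filter-∁-split [] = refl
    length-filter-∁-split (x ∷ xs) with P? x
    ... | yes _ = cong suc (length-filter-∁-split xs)
    ... | no _  = trans (cong suc (length-filter-∁-split xs)) (sym (+-suc _ _))

    module _ {Q R : Pred A 0ℓ} (Q? : Decidable Q) (R? : Decidable R) where

      filter-filter-cong : ∀ xs → (∀ {x} → x ∈ xs → (Q x × P x) ⇔ R x) → filter Q? (filter P? xs) ≡ filter R? xs
      filter-filter-cong [] _ = refl
      filter-filter-cong (x ∷ xs) QP⇔R with IH ← filter-filter-cong xs (λ x∈ → QP⇔R (there x∈)) | P? x
      ... | no ¬px = trans IH (sym (filter-reject R? (λ rx → ¬px (proj₂ (Equivalence.from (QP⇔R (here refl)) rx)))))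
      ... | yes px with Q? x
      ...   | yes qx = trans (cong (x ∷_) IH) (sym (filter-accept R? (Equivalence.to (QP⇔R (here refl)) (qx , px))))
      ...   | no ¬qx = trans IH (sym (filter-reject R? (λ rx → ¬qx (proj₁ (Equivalence.from (QP⇔R (here refl)) rx)))))

  module _ (_≟_ : DecidableEquality A) (f : A → A) where

    fixedPoints : List A → List A
    fixedPoints = filter (λ x → f x ≟ x)

    MapsInto : List A → Set
    MapsInto xs = ∀ {x} → x ∈ xs → f x ∈ xs

    InvolutiveOn : List A → Set
    InvolutiveOn xs = ∀ {x} → x ∈ xs → f (f x) ≡ x

    private
      remove : A → List A → List A
      remove y = filter (λ x → ¬? (x ≟ y))

      length-remove : ∀ {y xs} → Unique xs → y ∈ xs → suc (length (remove y xs)) ≡ length xs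
      length-remove {y} {x ∷ xs} (x∉xs ∷ _) (here refl) with x ≟ x
      ... | yes _  = cong (suc ∘ length) (filter-all (λ x → ¬? (x ≟ y)) (All.map (λ y≢x x≡y → y≢x (sym x≡y)) x∉xs))
      ... | no x≢x = ⊥-elim (x≢x refl)
      length-remove {y} {x ∷ xs} (x∉xs ∷ xs!) (there y∈xs) with x ≟ y
      ... | yes refl = ⊥-elim (All.lookup x∉xs y∈xs refl)
      ... | no _     = cong suc (length-remove xs! y∈xs)

      length-fixedPoints-remove : ∀ {y} xs → f y ≢ y → length (fixedPoints (remove y xs)) ≡ length (fixedPoints xs)
      length-fixedPoints-remove {y} [] _ = refl
      length-fixedPoints-remove {y} (x ∷ xs) fy≢y with x ≟ y
      ... | yes refl with f x ≟ x
      ...   | yes fx≡x = ⊥-elim (fy≢y fx≡x)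
      ...   | no _     = length-fixedPoints-remove xs fy≢y
      length-fixedPoints-remove {y} (x ∷ xs) fy≢y | no _ with f x ≟ x
      ...   | yes _ = cong suc (length-fixedPoints-remove xs fy≢y)
      ...   | no _  = length-fixedPoints-remove xs fy≢y

    involution-parity : ∀ {xs} → Unique xs → MapsInto xs → InvolutiveOn xs →
                        ∃ λ k → length xs ≡ 2 * k + length (fixedPoints xs)
    involution-parity {xs} = by-size (length xs) ≤-refl
      where
      by-size : ∀ n {xs} → length xs ≤ n → Unique xs → MapsInto xs → InvolutiveOn xs →
           ∃ λ k → length xs ≡ 2 * k + length (fixedPoints xs)
      by-size _ {[]} _ _ _ _ = 0 , refl
      by-size (suc n) {x ∷ xs} (s≤s len≤n) (x∉xs ∷ xs!) into invol with f x ≟ x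
      ... | yes fx≡x =
        let k , len≡ = by-size n len≤n xs! into-xs (λ y∈ → invol (there y∈)) in
        k , trans (cong suc len≡) (sym (+-suc (2 * k) _))
        where
        into-xs : MapsInto xs
        into-xs {y} y∈xs with into (there y∈xs)
        ... | there fy∈xs = fy∈xs
        ... | here fy≡x = ⊥-elim (All.lookup x∉xs y∈xs (trans (sym fx≡x) (trans (cong f (sym fy≡x)) (invol (there y∈xs)))))
      ... | no fx≢x =
        let k , len≡ = by-size n len-rest≤n (Unique.filter⁺ (λ z → ¬? (z ≟ fx)) xs!) into-rest (λ y∈ → invol (there (∈-filter⁻ _ y∈ .proj₁))) in
        suc k , (begin
          suc (length xs)                                    ≡⟨ cong suc (sym (length-remove xs! fx∈xs)) ⟩
          suc (suc (length rest))                            ≡⟨ cong (suc ∘ suc) len≡ ⟩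
          suc (suc (2 * k + length (fixedPoints rest)))      ≡⟨ cong (λ m → suc (suc (2 * k + m))) (length-fixedPoints-remove xs ffx≢fx) ⟩
          suc (suc (2 * k + length (fixedPoints xs)))        ≡⟨ cong (_+ length (fixedPoints xs)) (sym (*-suc 2 k)) ⟩
          2 * suc k + length (fixedPoints xs)                ∎)
        where
        open ≡-Reasoning
        fx : A
        fx = f x
        rest : List A
        rest = remove fx xs
        fx∈xs : fx ∈ xs
        fx∈xs with into (here refl)
        ... | here fx≡x = ⊥-elim (fx≢x fx≡x)
        ... | there fx∈xs = fx∈xs
        ffx≢fx : f fx ≢ fx
        ffx≢fx ffx≡fx = fx≢x (sym (trans (sym (invol (here refl))) ffx≡fx))
        len-rest≤n : length rest ≤ n
        len-rest≤n = ≤-trans (n≤1+n _) (subst (_≤ n) (sym (length-remove xs! fx∈xs)) len≤n)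
        into-rest : MapsInto rest
        into-rest {y} y∈rest with ∈-filter⁻ (λ z → ¬? (z ≟ fx)) {xs = xs} y∈rest
        ... | y∈xs , y≢fx with into (there y∈xs)
        ...   | here fy≡x = ⊥-elim (y≢fx (trans (sym (invol (there y∈xs))) (cong f fy≡x)))
        ...   | there fy∈xs = ∈-filter⁺ (λ z → ¬? (z ≟ fx)) fy∈xs
                  (λ fy≡fx → All.lookup x∉xs y∈xs (trans (sym (invol (here refl))) (trans (cong f (sym fy≡fx)) (invol (there y∈xs)))))

module DivisorSums where

  open import Defs using (χ₄)
  open FiniteChecks using (∀<²-by-decision)
  open Counting using (unique-⇔⇒↭)
  open import Data.Nat as ℕ using (ℕ; zero; suc; NonZero; _*_; _%_; _<_)
  open import Data.Nat.Properties as ℕ using (suc-injective; *-cancelˡ-≡; m*n≢0)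
  open import Data.Nat.DivMod using (%-distribˡ-*; m%n<n; [m+kn]%n≡m%n)
  open import Data.Nat.Divisibility using (_∣_; _∣?_; quotient; m∣n⇒n≡m*quotient; ∣⇒≤; 0∣⇒≡0; m∣m*n; ∣n⇒∣m*n; *-monoʳ-∣; *-cancelˡ-∣; ∣-trans)
  open import Data.Nat.Coprimality using (Coprime; coprime-divisor)
  open import Data.Nat.Primality using (Prime; prime⇒irreducible; prime⇒nonZero)
  open import Data.Integer as ℤ using (ℤ; +_; -_; _+_)
  open import Data.Integer.Properties as ℤ using (+-assoc; +-comm; *-zeroʳ; *-distribˡ-+)
  open import Data.Integer.Tactic.RingSolver using (solve-∀)
  open import Data.List using (List; []; _∷_; foldr; map; filter; upTo; _++_)
  open import Data.List.Properties using (map-++; map-∘; map-cong; filter-none)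
  import Data.List.Relation.Unary.All as All
  open import Data.List.Membership.Propositional using (_∈_)
  open import Data.List.Membership.Propositional.Properties using (∈-filter⁺; ∈-filter⁻; ∈-map⁺; ∈-map⁻; ∈-upTo⁺; ∈-++⁺ˡ; ∈-++⁺ʳ; ∈-++⁻)
  open import Data.List.Relation.Unary.Unique.Propositional using (Unique)
  import Data.List.Relation.Unary.Unique.Propositional.Properties as Unique
  open import Data.List.Relation.Binary.Permutation.Propositional using (_↭_; refl; prep; swap; trans)
  open import Data.List.Relation.Binary.Permutation.Propositional.Properties using (map⁺)
  open import Data.Product using (_×_; _,_; ∃; proj₁; proj₂)
  open import Data.Sum using (inj₁; inj₂)
  open import Data.Empty using (⊥-elim)
  open import Function.Base using (_∘_)
  open import Function.Bundles using (mk⇔)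
  open import Relation.Nullary using (¬_; yes; no)
  open import Relation.Unary.Properties using (∁?)
  open import Relation.Binary.PropositionalEquality as ≡ using (_≡_; cong; cong₂; sym; module ≡-Reasoning)

  sumℤ : List ℤ → ℤ
  sumℤ = foldr _+_ (+ 0)

  sumℤ-++ : ∀ xs ys → sumℤ (xs ++ ys) ≡ sumℤ xs + sumℤ ys
  sumℤ-++ [] ys = sym (ℤ.+-identityˡ _)
  sumℤ-++ (x ∷ xs) ys = ≡.trans (cong (_+_ x) (sumℤ-++ xs ys)) (sym (+-assoc x _ _))

  sumℤ-↭ : ∀ {xs ys} → xs ↭ ys → sumℤ xs ≡ sumℤ ys
  sumℤ-↭ refl = ≡.refl
  sumℤ-↭ (prep x xs↭ys) = cong (_+_ x) (sumℤ-↭ xs↭ys)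
  sumℤ-↭ (swap {xs} {ys} x y xs↭ys) = begin
    x + (y + sumℤ xs)   ≡⟨ sym (+-assoc x y _) ⟩
    (x + y) + sumℤ xs   ≡⟨ cong₂ _+_ (+-comm x y) (sumℤ-↭ xs↭ys) ⟩
    (y + x) + sumℤ ys   ≡⟨ +-assoc y x _ ⟩
    y + (x + sumℤ ys)   ∎
    where open ≡-Reasoning
  sumℤ-↭ (trans xs↭ys ys↭zs) = ≡.trans (sumℤ-↭ xs↭ys) (sumℤ-↭ ys↭zs)

  sumℤ-map-scale : ∀ c xs → sumℤ (map (c ℤ.*_) xs) ≡ c ℤ.* sumℤ xs
  sumℤ-map-scale c [] = sym (*-zeroʳ c)
  sumℤ-map-scale c (x ∷ xs) = ≡.trans (cong (_+_ (c ℤ.* x)) (sumℤ-map-scale c xs)) (sym (*-distribˡ-+ c x _))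

  -- The list of divisors used in divisorSumχ₄, so that divisorSum χ₄ m is divisorSumχ₄ m by definition.
  divisors : ℕ → List ℕ
  divisors m = filter (λ d → d ∣? m) (map suc (upTo m))

  divisorSum : (ℕ → ℤ) → ℕ → ℤ
  divisorSum f m = sumℤ (map f (divisors m))

  divisors-unique : ∀ m → Unique (divisors m)
  divisors-unique m = Unique.filter⁺ (λ d → d ∣? m) (Unique.map⁺ suc-injective (Unique.upTo⁺ m))

  ∈-divisors⁻ : ∀ {d m} → d ∈ divisors m → d ∣ m
  ∈-divisors⁻ {m = m} d∈ = proj₂ (∈-filter⁻ (λ d → d ∣? m) {xs = map suc (upTo m)} d∈)

  ∈-divisors⁺ : ∀ {d m} .{{_ : NonZero m}} → d ∣ m → d ∈ divisors m
  ∈-divisors⁺ {zero} {m} 0∣m = ⊥-elim (ℕ.≢-nonZero⁻¹ m (0∣⇒≡0 0∣m))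
  ∈-divisors⁺ {suc d} {m} d∣m = ∈-filter⁺ (λ d → d ∣? m) (∈-map⁺ suc (∈-upTo⁺ (∣⇒≤ d∣m))) d∣m

  divisorSum∤ divisorSum∣ : ℕ → (ℕ → ℤ) → ℕ → ℤ
  divisorSum∤ p f m = sumℤ (map f (filter (∁? (p ∣?_)) (divisors m)))
  divisorSum∣ p f m = sumℤ (map f (filter (p ∣?_) (divisors m)))

  divisorSum-split : ∀ p f m → divisorSum f m ≡ divisorSum∤ p f m + divisorSum∣ p f m
  divisorSum-split p f m = split (divisors m)
    where
    split : ∀ ds → sumℤ (map f ds) ≡ sumℤ (map f (filter (∁? (p ∣?_)) ds)) + sumℤ (map f (filter (p ∣?_) ds))
    split [] = ≡.refl
    split (d ∷ ds) with p ∣? d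
    ... | yes _ = ≡.trans (cong (_+_ (f d)) (split ds)) (x+[y+z]≡y+[x+z] (f d) (sumℤ (map f (filter (∁? (p ∣?_)) ds))) (sumℤ (map f (filter (p ∣?_) ds))))
      where
      x+[y+z]≡y+[x+z] : ∀ x y z → x + (y + z) ≡ y + (x + z)
      x+[y+z]≡y+[x+z] = solve-∀
    ... | no _ = ≡.trans (cong (_+_ (f d)) (split ds)) (sym (+-assoc (f d) _ _))

  ∤-prime⇒coprime : ∀ {p d} → Prime p → ¬ p ∣ d → Coprime d p
  ∤-prime⇒coprime p-prime p∤d (c∣d , c∣p) with prime⇒irreducible p-prime c∣p
  ... | inj₁ c≡1 = c≡1
  ... | inj₂ ≡.refl = ⊥-elim (p∤d c∣d)

  module _ {p : ℕ} (p-prime : Prime p) where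

    private
      instance
        p≢0 : NonZero p
        p≢0 = prime⇒nonZero p-prime

      ∣⇒≡p* : ∀ {d} → p ∣ d → ∃ λ e → d ≡ p * e
      ∣⇒≡p* p∣d = quotient p∣d , m∣n⇒n≡m*quotient p∣d

      p*-unique : ∀ {ds} → Unique ds → Unique (map (p *_) ds)
      p*-unique = Unique.map⁺ (*-cancelˡ-≡ _ _ p)

    -- A divisor of p m is either prime to p, hence a divisor of m, or p times a divisor of m.
    divisors-*-prime : ∀ m .{{_ : NonZero m}} →
                       divisors (p * m) ↭ filter (∁? (p ∣?_)) (divisors m) ++ map (p *_) (divisors m)
    divisors-*-prime m = unique-⇔⇒↭ (divisors-unique (p * m)) rhs-unique (mk⇔ to from)
      where
      instance
        pm≢0 : NonZero (p * m)
        pm≢0 = m*n≢0 p m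
      rhs-unique : Unique (filter (∁? (p ∣?_)) (divisors m) ++ map (p *_) (divisors m))
      rhs-unique = Unique.++⁺ (Unique.filter⁺ (∁? (p ∣?_)) (divisors-unique m)) (p*-unique (divisors-unique m)) disjoint
        where
        disjoint : ∀ {d} → ¬ (d ∈ filter (∁? (p ∣?_)) (divisors m) × d ∈ map (p *_) (divisors m))
        disjoint (d∈ˡ , d∈ʳ) with ∈-map⁻ (p *_) d∈ʳ
        ... | e , _ , ≡.refl = proj₂ (∈-filter⁻ (∁? (p ∣?_)) {xs = divisors m} d∈ˡ) (m∣m*n e)
      to : ∀ {d} → d ∈ divisors (p * m) → d ∈ filter (∁? (p ∣?_)) (divisors m) ++ map (p *_) (divisors m)
      to {d} d∈ with p ∣? d
      ... | no p∤d = ∈-++⁺ˡ (∈-filter⁺ (∁? (p ∣?_)) (∈-divisors⁺ (coprime-divisor (∤-prime⇒coprime p-prime p∤d) (∈-divisors⁻ d∈))) p∤d)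
      ... | yes p∣d with ∣⇒≡p* p∣d
      ...   | e , ≡.refl = ∈-++⁺ʳ _ (∈-map⁺ (p *_) (∈-divisors⁺ (*-cancelˡ-∣ p (∈-divisors⁻ d∈))))
      from : ∀ {d} → d ∈ filter (∁? (p ∣?_)) (divisors m) ++ map (p *_) (divisors m) → d ∈ divisors (p * m)
      from d∈ with ∈-++⁻ (filter (∁? (p ∣?_)) (divisors m)) d∈
      ... | inj₁ d∈ˡ = ∈-divisors⁺ (∣n⇒∣m*n p (∈-divisors⁻ (proj₁ (∈-filter⁻ (∁? (p ∣?_)) d∈ˡ))))
      ... | inj₂ d∈ʳ with ∈-map⁻ (p *_) d∈ʳ
      ...   | e , e∈ , ≡.refl = ∈-divisors⁺ (*-monoʳ-∣ p (∈-divisors⁻ e∈))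

    filter-∣-divisors-*-prime : ∀ k .{{_ : NonZero k}} → filter (p ∣?_) (divisors (p * k)) ↭ map (p *_) (divisors k)
    filter-∣-divisors-*-prime k = unique-⇔⇒↭ (Unique.filter⁺ (p ∣?_) (divisors-unique (p * k))) (p*-unique (divisors-unique k)) (mk⇔ to from)
      where
      instance
        pk≢0 : NonZero (p * k)
        pk≢0 = m*n≢0 p k
      to : ∀ {d} → d ∈ filter (p ∣?_) (divisors (p * k)) → d ∈ map (p *_) (divisors k)
      to d∈ with ∈-filter⁻ (p ∣?_) {xs = divisors (p * k)} d∈
      ... | d∈divisors , p∣d with ∣⇒≡p* p∣d
      ...   | e , ≡.refl = ∈-map⁺ (p *_) (∈-divisors⁺ (*-cancelˡ-∣ p (∈-divisors⁻ d∈divisors)))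
      from : ∀ {d} → d ∈ map (p *_) (divisors k) → d ∈ filter (p ∣?_) (divisors (p * k))
      from d∈ with ∈-map⁻ (p *_) d∈
      ... | e , e∈ , ≡.refl = ∈-filter⁺ (p ∣?_) (∈-divisors⁺ (*-monoʳ-∣ p (∈-divisors⁻ e∈))) (m∣m*n e)

    module _ (f : ℕ → ℤ) (f-* : ∀ d → f (p * d) ≡ f p ℤ.* f d) where

      private
        sum-map-p* : ∀ ds → sumℤ (map f (map (p *_) ds)) ≡ f p ℤ.* sumℤ (map f ds)
        sum-map-p* ds = begin
          sumℤ (map f (map (p *_) ds))     ≡⟨ cong sumℤ (sym (map-∘ ds)) ⟩
          sumℤ (map (λ d → f (p * d)) ds)  ≡⟨ cong sumℤ (map-cong f-* ds) ⟩
          sumℤ (map (λ d → f p ℤ.* f d) ds)  ≡⟨ cong sumℤ (map-∘ ds) ⟩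
          sumℤ (map (f p ℤ.*_) (map f ds))   ≡⟨ sumℤ-map-scale (f p) (map f ds) ⟩
          f p ℤ.* sumℤ (map f ds)          ∎
          where open ≡-Reasoning

      divisorSum-*-prime : ∀ m .{{_ : NonZero m}} → divisorSum f (p * m) ≡ divisorSum∤ p f m + f p ℤ.* divisorSum f m
      divisorSum-*-prime m = begin
        sumℤ (map f (divisors (p * m)))                                                    ≡⟨ sumℤ-↭ (map⁺ f (divisors-*-prime m)) ⟩
        sumℤ (map f (filter (∁? (p ∣?_)) (divisors m) ++ map (p *_) (divisors m)))       ≡⟨ cong sumℤ (map-++ f (filter (∁? (p ∣?_)) (divisors m)) _) ⟩
        sumℤ (map f (filter (∁? (p ∣?_)) (divisors m)) ++ map f (map (p *_) (divisors m))) ≡⟨ sumℤ-++ (map f (filter (∁? (p ∣?_)) (divisors m))) _ ⟩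
        divisorSum∤ p f m + sumℤ (map f (map (p *_) (divisors m)))                        ≡⟨ cong (_+_ (divisorSum∤ p f m)) (sum-map-p* (divisors m)) ⟩
        divisorSum∤ p f m + f p ℤ.* divisorSum f m                                           ∎
        where open ≡-Reasoning

      divisorSum∣-*-prime : ∀ k .{{_ : NonZero k}} → divisorSum∣ p f (p * k) ≡ f p ℤ.* divisorSum f k
      divisorSum∣-*-prime k = ≡.trans (sumℤ-↭ (map⁺ f (filter-∣-divisors-*-prime k))) (sum-map-p* (divisors k))

    divisorSum∣-∤ : ∀ f {m} → ¬ p ∣ m → divisorSum∣ p f m ≡ + 0
    divisorSum∣-∤ f {m} p∤m = cong (sumℤ ∘ map f) (filter-none (p ∣?_) (All.tabulate (λ d∈ p∣d → p∤m (∣-trans p∣d (∈-divisors⁻ d∈)))))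

  private
    χ₄-residue : ℕ → ℤ
    χ₄-residue 1 = + 1
    χ₄-residue 3 = - + 1
    χ₄-residue _ = + 0

    χ₄≡χ₄-residue : ∀ d → χ₄ d ≡ χ₄-residue (d % 4)
    χ₄≡χ₄-residue d with d % 4
    ... | 0 = ≡.refl
    ... | 1 = ≡.refl
    ... | 2 = ≡.refl
    ... | 3 = ≡.refl
    ... | suc (suc (suc (suc _))) = ≡.refl

    χ₄[r+4k] : ∀ r k → χ₄ (r ℕ.+ 4 * k) ≡ χ₄-residue (r % 4)
    χ₄[r+4k] r k = ≡.trans (χ₄≡χ₄-residue (r ℕ.+ 4 * k)) (cong χ₄-residue (≡.trans (cong (λ n → (r ℕ.+ n) % 4) (ℕ.*-comm 4 k)) ([m+kn]%n≡m%n r k 4)))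

  χ₄-* : ∀ m n → χ₄ (m * n) ≡ χ₄ m ℤ.* χ₄ n
  χ₄-* m n = begin
    χ₄ (m * n)                                     ≡⟨ χ₄≡χ₄-residue (m * n) ⟩
    χ₄-residue ((m * n) % 4)                       ≡⟨ cong χ₄-residue (%-distribˡ-* m n 4) ⟩
    χ₄-residue ((m % 4 * (n % 4)) % 4)             ≡⟨ χ₄-residue-* (m%n<n m 4) (m%n<n n 4) ⟩
    χ₄-residue (m % 4) ℤ.* χ₄-residue (n % 4)      ≡⟨ sym (cong₂ ℤ._*_ (χ₄≡χ₄-residue m) (χ₄≡χ₄-residue n)) ⟩
    χ₄ m ℤ.* χ₄ n                                  ∎
    where
    open ≡-Reasoning
    χ₄-residue-* : ∀ {r s} → r < 4 → s < 4 → χ₄-residue ((r * s) % 4) ≡ χ₄-residue r ℤ.* χ₄-residue s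
    χ₄-residue-* = ∀<²-by-decision (λ r s → χ₄-residue ((r * s) % 4) ℤ.≟ χ₄-residue r ℤ.* χ₄-residue s) 4 _

  χ₄[1+4k] : ∀ k → χ₄ (1 ℕ.+ 4 * k) ≡ + 1
  χ₄[1+4k] = χ₄[r+4k] 1

  χ₄[3+4k] : ∀ k → χ₄ (3 ℕ.+ 4 * k) ≡ - + 1
  χ₄[3+4k] = χ₄[r+4k] 3

module LatticePoints where

  open import Defs using (intRange)
  open Counting using (length-filter-bijection)
  open import Data.Nat as ℕ using (ℕ; zero; suc; z≤n; s≤s)
  import Data.Nat.Properties as ℕ
  open import Data.Integer using (ℤ; +_; -[1+_]; -_; _+_; _*_; ∣_∣; _≟_)
  open import Data.Integer.Properties using (+-injective; +-comm; pos-*; pos-+)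
  open import Data.List using (List; length; filter; map; upTo; cartesianProduct)
  open import Data.List.Membership.Propositional using (_∈_)
  open import Data.List.Membership.Propositional.Properties using (∈-filter⁺; ∈-filter⁻; ∈-map⁺; ∈-map⁻; ∈-++⁺ˡ; ∈-++⁺ʳ; ∈-upTo⁺; ∈-cartesianProduct⁺)
  open import Data.List.Relation.Unary.Unique.Propositional using (Unique)
  import Data.List.Relation.Unary.Unique.Propositional.Properties as Unique
  open import Data.Product using (_×_; _,_; ∃; proj₂)
  open import Level using (0ℓ)
  open import Relation.Nullary using (¬_)
  open import Relation.Unary using (Pred; Decidable)
  open import Relation.Binary.PropositionalEquality using (_≡_; refl; sym; trans; cong)

  intRange-unique : ∀ n → Unique (intRange n)
  intRange-unique n = Unique.++⁺ (Unique.map⁺ +-injective (Unique.upTo⁺ (suc n))) (Unique.map⁺ -suc-injective (Unique.upTo⁺ n)) disjoint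
    where
    -suc-injective : ∀ {i j} → - (+ suc i) ≡ - (+ suc j) → i ≡ j
    -suc-injective refl = refl
    disjoint : ∀ {x} → ¬ (x ∈ map +_ (upTo (suc n)) × x ∈ map (λ i → - (+ suc i)) (upTo n))
    disjoint (x∈⁺ , x∈⁻) with ∈-map⁻ +_ x∈⁺ | ∈-map⁻ (λ i → - (+ suc i)) x∈⁻
    ... | _ , _ , refl | _ , _ , ()

  ∈-intRange : ∀ {n} x → ∣ x ∣ ℕ.≤ n → x ∈ intRange n
  ∈-intRange {n} (+ k) k≤n = ∈-++⁺ˡ (∈-map⁺ +_ (∈-upTo⁺ (s≤s k≤n)))
  ∈-intRange {n} -[1+ k ] k<n = ∈-++⁺ʳ (map +_ (upTo (suc n))) (∈-map⁺ (λ i → - (+ suc i)) (∈-upTo⁺ k<n))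

  x*x≡∣x∣² : ∀ x → x * x ≡ + (∣ x ∣ ℕ.* ∣ x ∣)
  x*x≡∣x∣² (+ k) = sym (pos-* k k)
  x*x≡∣x∣² -[1+ k ] = refl

  n≤n*n : ∀ n → n ℕ.≤ n ℕ.* n
  n≤n*n zero = z≤n
  n≤n*n (suc n) = ℕ.m≤m*n (suc n) (suc n)

  ∣x∣≤n : ∀ {x n} r → x * x + + r ≡ + n → ∣ x ∣ ℕ.≤ n
  ∣x∣≤n {x} r eq = ℕ.≤-trans (n≤n*n ∣ x ∣) (ℕ.≤-trans (ℕ.m≤m+n _ r) (ℕ.≤-reflexive (+-injective (trans (pos-+ _ r) (trans (cong (_+ + r) (sym (x*x≡∣x∣² x))) eq)))))

  ℤ² : Set
  ℤ² = ℤ × ℤ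

  norm : ℤ² → ℤ
  norm (x , y) = x * x + y * y

  square : ℕ → List ℤ²
  square n = cartesianProduct (intRange n) (intRange n)

  square-unique : ∀ n → Unique (square n)
  square-unique n = Unique.cartesianProduct⁺ (intRange-unique n) (intRange-unique n)

  norm≡⇒∈square : ∀ {n} z → norm z ≡ + n → z ∈ square n
  norm≡⇒∈square {n} (x , y) eq = ∈-cartesianProduct⁺ (∈-intRange x (∣x∣≤n {x} (∣ y ∣ ℕ.* ∣ y ∣) x-first)) (∈-intRange y (∣x∣≤n {y} (∣ x ∣ ℕ.* ∣ x ∣) y-first))
    where
    x-first : x * x + + (∣ y ∣ ℕ.* ∣ y ∣) ≡ + n
    x-first = trans (cong (_+_ (x * x)) (sym (x*x≡∣x∣² y))) eq
    y-first : y * y + + (∣ x ∣ ℕ.* ∣ x ∣) ≡ + n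
    y-first = trans (+-comm (y * y) _) (trans (cong (_+ y * y) (sym (x*x≡∣x∣² x))) eq)

  pointsOfNorm : ℕ → List ℤ²
  pointsOfNorm n = filter (λ z → norm z ≟ + n) (square n)

  r₂ : ℕ → ℕ
  r₂ n = length (pointsOfNorm n)

  pointsOfNorm-unique : ∀ n → Unique (pointsOfNorm n)
  pointsOfNorm-unique n = Unique.filter⁺ (λ z → norm z ≟ + n) (square-unique n)

  ∈-pointsOfNorm⁺ : ∀ {n z} → norm z ≡ + n → z ∈ pointsOfNorm n
  ∈-pointsOfNorm⁺ {n} {z} eq = ∈-filter⁺ (λ z → norm z ≟ + n) (norm≡⇒∈square z eq) eq

  ∈-pointsOfNorm⁻ : ∀ {n z} → z ∈ pointsOfNorm n → norm z ≡ + n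
  ∈-pointsOfNorm⁻ {n} z∈ = proj₂ (∈-filter⁻ (λ z → norm z ≟ + n) {xs = square n} z∈)

  module _ {m n : ℕ} {Q : Pred ℤ² 0ℓ} (Q? : Decidable Q) (f : ℤ² → ℤ²) where

    r₂-bijection : (∀ {w} → norm w ≡ + m → norm (f w) ≡ + n × Q (f w)) →
                   (∀ {w w′} → norm w ≡ + m → norm w′ ≡ + m → f w ≡ f w′ → w ≡ w′) →
                   (∀ {z} → norm z ≡ + n → Q z → ∃ λ w → norm w ≡ + m × f w ≡ z) →
                   r₂ m ≡ length (filter Q? (pointsOfNorm n))
    r₂-bijection into injective onto =
      length-filter-bijection (λ z → norm z ≟ + m) Q? (square-unique m) (pointsOfNorm-unique n) f
        (λ _ nw → let nfw , qfw = into nw in ∈-pointsOfNorm⁺ nfw , qfw)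
        (λ _ nw _ nw′ → injective nw nw′)
        (λ z∈ qz → let w , nw , fw≡z = onto (∈-pointsOfNorm⁻ z∈) qz in w , norm≡⇒∈square w nw , nw , fw≡z)

module GaussianCounts where

  open LatticePoints using (ℤ²; norm; pointsOfNorm; r₂; ∈-pointsOfNorm⁻; r₂-bijection)
  open Counting using (length-filter-∁-split; filter-filter-cong)
  open import Data.Nat as ℕ using (ℕ)
  import Data.Nat.Divisibility as ℕ
  import Data.Nat.Properties as ℕ
  open import Data.Nat.Primality using (Prime; euclidsLemma; prime⇒nonZero; prime[2])
  open import Data.Integer using (ℤ; +_; -_; _+_; _-_; _*_; NonZero) renaming (∣_∣ to abs)
  open import Data.Integer.Properties using (*-cancelˡ-≡; pos-*; abs-*; +-comm; *-comm; neg-involutive)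
  open import Data.Integer.Divisibility.Signed using (_∣_; _∣?_; divides; ∣⇒∣ᵤ; ∣ᵤ⇒∣; ∣m∣n⇒∣m+n; ∣m∣n⇒∣m-n; ∣n⇒∣m*n; ∣m⇒∣m*n; ∣-refl; ∣m⇒∣-m)
  open import Data.Integer.Tactic.RingSolver using (solve-∀)
  open import Data.List using (List; length; filter)
  open import Data.List.Membership.Propositional using (_∈_)
  open import Data.List.Properties using (filter-all; filter-none)
  import Data.List.Relation.Unary.All as All
  open import Data.Product using (_×_; _,_; ∃; proj₁; proj₂)
  open import Data.Sum using (_⊎_; inj₁; inj₂; [_,_]′)
  open import Data.Empty using (⊥-elim)
  open import Function.Bundles using (_⇔_; mk⇔)
  open import Relation.Nullary using (¬_)
  open import Relation.Nullary.Decidable using (_×-dec_)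
  open import Relation.Unary using (Decidable)
  open import Relation.Unary.Properties using (∁?)
  open import Relation.Binary.PropositionalEquality using (_≡_; refl; sym; trans; cong; cong₂; subst; module ≡-Reasoning)

  infixl 7 _·_
  infixr 7 _⋆_

  _·_ : ℤ² → ℤ² → ℤ²
  (a , b) · (u , v) = (a * u - b * v , a * v + b * u)

  conj : ℤ² → ℤ²
  conj (a , b) = (a , - b)

  _⋆_ : ℤ → ℤ² → ℤ²
  c ⋆ (u , v) = (c * u , c * v)

  norm-· : ∀ g w → norm (g · w) ≡ norm g * norm w
  norm-· (a , b) (u , v) = identity a b u v
    where
    identity : ∀ a b u v → (a * u - b * v) * (a * u - b * v) + (a * v + b * u) * (a * v + b * u) ≡ (a * a + b * b) * (u * u + v * v)
    identity = solve-∀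

  norm-conj : ∀ g → norm (conj g) ≡ norm g
  norm-conj (a , b) = cong (_+_ (a * a)) (identity b)
    where
    identity : ∀ b → - b * - b ≡ b * b
    identity = solve-∀

  ·-conj-· : ∀ g w → g · (conj g · w) ≡ norm g ⋆ w
  ·-conj-· (a , b) (u , v) = cong₂ _,_ (re a b u v) (im a b u v)
    where
    re : ∀ a b u v → a * (a * u - - b * v) - b * (a * v + - b * u) ≡ (a * a + b * b) * u
    re = solve-∀
    im : ∀ a b u v → a * (a * v + - b * u) + b * (a * u - - b * v) ≡ (a * a + b * b) * v
    im = solve-∀

  conj-·-· : ∀ g w → conj g · (g · w) ≡ norm g ⋆ w
  conj-·-· (a , b) (u , v) = cong₂ _,_ (re a b u v) (im a b u v)
    where
    re : ∀ a b u v → a * (a * u - b * v) - - b * (a * v + b * u) ≡ (a * a + b * b) * u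
    re = solve-∀
    im : ∀ a b u v → a * (a * v + b * u) + - b * (a * u - b * v) ≡ (a * a + b * b) * v
    im = solve-∀

  ·-⋆ : ∀ g c w → g · (c ⋆ w) ≡ c ⋆ (g · w)
  ·-⋆ (a , b) c (u , v) = cong₂ _,_ (re a b c u v) (im a b c u v)
    where
    re : ∀ a b c u v → a * (c * u) - b * (c * v) ≡ c * (a * u - b * v)
    re = solve-∀
    im : ∀ a b c u v → a * (c * v) + b * (c * u) ≡ c * (a * v + b * u)
    im = solve-∀

  Im[g]*Im[g·w] : ∀ g w → proj₂ g * proj₂ (g · w) ≡ norm g * proj₁ w - proj₁ g * proj₁ (g · w)
  Im[g]*Im[g·w] (a , b) (u , v) = identity a b u v
    where
    identity : ∀ a b u v → b * (a * v + b * u) ≡ (a * a + b * b) * u - a * (a * u - b * v)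
    identity = solve-∀

  ⋆-cancel : ∀ c .{{_ : NonZero c}} {w w′} → c ⋆ w ≡ c ⋆ w′ → w ≡ w′
  ⋆-cancel c {u , v} {u′ , v′} eq = cong₂ _,_ (*-cancelˡ-≡ c u u′ (cong proj₁ eq)) (*-cancelˡ-≡ c v v′ (cong proj₂ eq))

  euclid-ℤ : ∀ {p} → Prime p → ∀ a b → + p ∣ a * b → + p ∣ a ⊎ + p ∣ b
  euclid-ℤ p-prime a b p∣ab with euclidsLemma (abs a) (abs b) p-prime (subst (ℕ._∣_ _) (abs-* a b) (∣⇒∣ᵤ p∣ab))
  ... | inj₁ p∣a = inj₁ (∣ᵤ⇒∣ p∣a)
  ... | inj₂ p∣b = inj₂ (∣ᵤ⇒∣ p∣b)

  ∣-cancelˡ-* : ∀ {p} → Prime p → ∀ {a b} → ¬ + p ∣ a → + p ∣ a * b → + p ∣ b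
  ∣-cancelˡ-* p-prime {a} {b} p∤a p∣ab = [ (λ p∣a → ⊥-elim (p∤a p∣a)) , (λ p∣b → p∣b) ]′ (euclid-ℤ p-prime a b p∣ab)

  +p∣+[p*m] : ∀ p m → + p ∣ + (p ℕ.* m)
  +p∣+[p*m] p m = divides (+ m) (trans (pos-* p m) (*-comm (+ p) (+ m)))

  r₂∣ : ℕ → ℕ → ℕ
  r₂∣ p n = length (filter (λ z → (+ p ∣? proj₁ z) ×-dec (+ p ∣? proj₂ z)) (pointsOfNorm n))

  module _ {p : ℕ} (p-prime : Prime p) where

    private
      instance
        p≢0 : NonZero (+ p)
        p≢0 = prime⇒nonZero p-prime

    -- For h of norm p, the points z with p ∣ Re (h z) are exactly the multiples of conj h.
    module _ {h : ℤ²} (norm-h : norm h ≡ + p) (p∤Im-h : ¬ + p ∣ proj₂ h) where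

      r₂≡#[p∣Re[h·z]] : ∀ m → r₂ m ≡ length (filter (λ z → + p ∣? proj₁ (h · z)) (pointsOfNorm (p ℕ.* m)))
      r₂≡#[p∣Re[h·z]] m = r₂-bijection (λ z → + p ∣? proj₁ (h · z)) (conj h ·_) into injective onto
        where
        norm-conj-h·w : ∀ w → norm (conj h · w) ≡ + p * norm w
        norm-conj-h·w w = trans (norm-· (conj h) w) (cong (_* norm w) (trans (norm-conj h) norm-h))
        h·conj-h·w : ∀ w → h · (conj h · w) ≡ + p ⋆ w
        h·conj-h·w w = trans (·-conj-· h w) (cong (_⋆ w) norm-h)
        into : ∀ {w} → norm w ≡ + m → norm (conj h · w) ≡ + (p ℕ.* m) × + p ∣ proj₁ (h · (conj h · w))
        into {w} nw = trans (norm-conj-h·w w) (trans (cong (+ p *_) nw) (sym (pos-* p m)))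
                    , subst (λ v → + p ∣ proj₁ v) (sym (h·conj-h·w w)) (∣m⇒∣m*n (proj₁ w) ∣-refl)
        injective : ∀ {w w′} → norm w ≡ + m → norm w′ ≡ + m → conj h · w ≡ conj h · w′ → w ≡ w′
        injective {w} {w′} _ _ eq = ⋆-cancel (+ p) (trans (sym (h·conj-h·w w)) (trans (cong (h ·_) eq) (h·conj-h·w w′)))
        p∣Re⇒p∣Im[h]*Im : ∀ z → + p ∣ proj₁ (h · z) → + p ∣ proj₂ h * proj₂ (h · z)
        p∣Re⇒p∣Im[h]*Im z p∣Re = subst (+ p ∣_) (sym (Im[g]*Im[g·w] h z))
          (∣m∣n⇒∣m-n (subst (λ c → + p ∣ c * proj₁ z) (sym norm-h) (∣m⇒∣m*n (proj₁ z) ∣-refl)) (∣n⇒∣m*n (proj₁ h) p∣Re))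
        onto : ∀ {z} → norm z ≡ + (p ℕ.* m) → + p ∣ proj₁ (h · z) → ∃ λ w → norm w ≡ + m × conj h · w ≡ z
        onto {z} nz p∣Re = from-quotients p∣Re (∣-cancelˡ-* p-prime p∤Im-h (p∣Re⇒p∣Im[h]*Im z p∣Re))
          where
          from-quotients : + p ∣ proj₁ (h · z) → + p ∣ proj₂ (h · z) → ∃ λ w → norm w ≡ + m × conj h · w ≡ z
          from-quotients (divides q₁ Re≡q₁p) (divides q₂ Im≡q₂p) = w , norm-w , conj-h·w≡z
            where
            w : ℤ²
            w = (q₁ , q₂)
            h·z≡p⋆w : h · z ≡ + p ⋆ w
            h·z≡p⋆w = cong₂ _,_ (trans Re≡q₁p (*-comm q₁ (+ p))) (trans Im≡q₂p (*-comm q₂ (+ p)))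
            conj-h·w≡z : conj h · w ≡ z
            conj-h·w≡z = ⋆-cancel (+ p) (begin
              + p ⋆ (conj h · w)   ≡⟨ sym (·-⋆ (conj h) (+ p) w) ⟩
              conj h · (+ p ⋆ w)   ≡⟨ cong (conj h ·_) (sym h·z≡p⋆w) ⟩
              conj h · (h · z)     ≡⟨ conj-·-· h z ⟩
              norm h ⋆ z           ≡⟨ cong (_⋆ z) norm-h ⟩
              + p ⋆ z              ∎)
              where open ≡-Reasoning
            norm-w : norm w ≡ + m
            norm-w = *-cancelˡ-≡ (+ p) (norm w) (+ m) (trans (sym (norm-conj-h·w w)) (trans (cong norm conj-h·w≡z) (trans nz (pos-* p m))))

    module _ {g : ℤ²} (norm-g : norm g ≡ + p) (p∤Re-g : ¬ + p ∣ proj₁ g) (p∤Im-g : ¬ + p ∣ proj₂ g) (p∤2 : ¬ + p ∣ + 2) where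

      multiple-of-g⊎conj-g : ∀ {m z} → norm z ≡ + (p ℕ.* m) → + p ∣ proj₁ (conj g · z) ⊎ + p ∣ proj₁ (g · z)
      multiple-of-g⊎conj-g {m} {z} norm-z = euclid-ℤ p-prime _ _ (subst (+ p ∣_) (sym (product-identity g z))
        (∣m∣n⇒∣m-n (∣n⇒∣m*n (proj₁ g * proj₁ g) (subst (+ p ∣_) (sym norm-z) (+p∣+[p*m] p m)))
                   (subst (λ c → + p ∣ c * (proj₂ z * proj₂ z)) (sym norm-g) (∣m⇒∣m*n (proj₂ z * proj₂ z) ∣-refl))))
        where
        product-identity : ∀ g z → proj₁ (conj g · z) * proj₁ (g · z) ≡ proj₁ g * proj₁ g * norm z - norm g * (proj₂ z * proj₂ z)
        product-identity (a , b) (x , y) = identity a b x y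
          where
          identity : ∀ a b x y → (a * x - - b * y) * (a * x - b * y) ≡ a * a * (x * x + y * y) - (a * a + b * b) * (y * y)
          identity = solve-∀

      multiple-of-g×conj-g⇔p∣z : ∀ z → (+ p ∣ proj₁ (conj g · z) × + p ∣ proj₁ (g · z)) ⇔ (+ p ∣ proj₁ z × + p ∣ proj₂ z)
      multiple-of-g×conj-g⇔p∣z (x , y) = mk⇔ to from
        where
        p∤2*-cancel : ∀ {c} → ¬ + p ∣ c → ∀ {w} → + p ∣ (+ 2 * c) * w → + p ∣ w
        p∤2*-cancel p∤c = ∣-cancelˡ-* p-prime (λ p∣2c → [ p∤2 , p∤c ]′ (euclid-ℤ p-prime _ _ p∣2c))
        sum-identity : ∀ a b x y → (a * x - - b * y) + (a * x - b * y) ≡ (+ 2 * a) * x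
        sum-identity = solve-∀
        difference-identity : ∀ a b x y → (a * x - - b * y) - (a * x - b * y) ≡ (+ 2 * b) * y
        difference-identity = solve-∀
        to : + p ∣ proj₁ (conj g · (x , y)) × + p ∣ proj₁ (g · (x , y)) → + p ∣ x × + p ∣ y
        to (p∣L , p∣L′) =
          p∤2*-cancel p∤Re-g (subst (+ p ∣_) (sum-identity (proj₁ g) (proj₂ g) x y) (∣m∣n⇒∣m+n p∣L p∣L′)) ,
          p∤2*-cancel p∤Im-g (subst (+ p ∣_) (difference-identity (proj₁ g) (proj₂ g) x y) (∣m∣n⇒∣m-n p∣L p∣L′))
        from : + p ∣ x × + p ∣ y → + p ∣ proj₁ (conj g · (x , y)) × + p ∣ proj₁ (g · (x , y))
        from (p∣x , p∣y) = ∣m∣n⇒∣m-n (∣n⇒∣m*n (proj₁ g) p∣x) (∣n⇒∣m*n (- proj₂ g) p∣y)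
                         , ∣m∣n⇒∣m-n (∣n⇒∣m*n (proj₁ g) p∣x) (∣n⇒∣m*n (proj₂ g) p∣y)

      -- Inclusion–exclusion over the multiples of g and of conj g among the points of norm p m.
      r₂[p*m]+r₂∣≡2*r₂[m] : ∀ m → r₂ (p ℕ.* m) ℕ.+ r₂∣ p (p ℕ.* m) ≡ r₂ m ℕ.+ r₂ m
      r₂[p*m]+r₂∣≡2*r₂[m] m = begin
        r₂ (p ℕ.* m) ℕ.+ #[ B? ] N                                             ≡⟨ cong₂ ℕ._+_ (length-filter-∁-split L? N) (cong length (sym L∘L′≡B)) ⟩
        (#[ L? ] N ℕ.+ #[ ∁? L? ] N) ℕ.+ #[ L? ] (filter L′? N)                 ≡⟨ ℕ.+-assoc (#[ L? ] N) _ _ ⟩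
        #[ L? ] N ℕ.+ (#[ ∁? L? ] N ℕ.+ #[ L? ] (filter L′? N))                 ≡⟨ cong (#[ L? ] N ℕ.+_) (ℕ.+-comm (#[ ∁? L? ] N) _) ⟩
        #[ L? ] N ℕ.+ (#[ L? ] (filter L′? N) ℕ.+ #[ ∁? L? ] N)                 ≡⟨ cong (λ k → #[ L? ] N ℕ.+ (#[ L? ] (filter L′? N) ℕ.+ length k)) (sym ¬L∘L′≡¬L) ⟩
        #[ L? ] N ℕ.+ (#[ L? ] (filter L′? N) ℕ.+ #[ ∁? L? ] (filter L′? N))    ≡⟨ cong (#[ L? ] N ℕ.+_) (sym (length-filter-∁-split L? (filter L′? N))) ⟩
        #[ L? ] N ℕ.+ #[ L′? ] N                                                ≡⟨ sym (cong₂ ℕ._+_ multiples-of-g multiples-of-conj-g) ⟩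
        r₂ m ℕ.+ r₂ m                                                          ∎
        where
        open ≡-Reasoning
        #[_]_ : ∀ {P : ℤ² → Set} → Decidable P → List ℤ² → ℕ
        #[ P? ] zs = length (filter P? zs)
        N : List ℤ²
        N = pointsOfNorm (p ℕ.* m)
        L? L′? B? : Decidable _
        L? z = + p ∣? proj₁ (conj g · z)
        L′? z = + p ∣? proj₁ (g · z)
        B? z = (+ p ∣? proj₁ z) ×-dec (+ p ∣? proj₂ z)
        multiples-of-g : r₂ m ≡ #[ L? ] N
        multiples-of-g = r₂≡#[p∣Re[h·z]] {conj g} (trans (norm-conj g) norm-g) (λ p∣-b → p∤Im-g (subst (+ p ∣_) (neg-involutive _) (∣m⇒∣-m p∣-b))) m
        multiples-of-conj-g : r₂ m ≡ #[ L′? ] N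
        multiples-of-conj-g = r₂≡#[p∣Re[h·z]] {g} norm-g p∤Im-g m
        L∘L′≡B : filter L? (filter L′? N) ≡ filter B? N
        L∘L′≡B = filter-filter-cong L′? L? B? N (λ {z} _ → multiple-of-g×conj-g⇔p∣z z)
        ¬L∘L′≡¬L : filter (∁? L?) (filter L′? N) ≡ filter (∁? L?) N
        ¬L∘L′≡¬L = filter-filter-cong L′? (∁? L?) (∁? L?) N (λ z∈N → mk⇔ proj₁ (λ p∤L → p∤L ,
          [ (λ p∣L → ⊥-elim (p∤L p∣L)) , (λ p∣L′ → p∣L′) ]′ (multiple-of-g⊎conj-g {m} (∈-pointsOfNorm⁻ z∈N))))

    r₂≡r₂∣ : (∀ x y → + p ∣ x * x + y * y → + p ∣ x) → ∀ n → + p ∣ + n → r₂ n ≡ r₂∣ p n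
    r₂≡r₂∣ p∣x²+y²⇒p∣x n p∣n = sym (cong length (filter-all _ (All.tabulate both-divisible)))
      where
      both-divisible : ∀ {z} → z ∈ pointsOfNorm n → + p ∣ proj₁ z × + p ∣ proj₂ z
      both-divisible {x , y} z∈ = p∣x²+y²⇒p∣x x y p∣norm , p∣x²+y²⇒p∣x y x (subst (+ p ∣_) (+-comm (x * x) (y * y)) p∣norm)
        where
        p∣norm : + p ∣ x * x + y * y
        p∣norm = subst (+ p ∣_) (sym (∈-pointsOfNorm⁻ z∈)) p∣n

    r₂∣[p*[p*k]]≡r₂[k] : ∀ k → r₂∣ p (p ℕ.* (p ℕ.* k)) ≡ r₂ k
    r₂∣[p*[p*k]]≡r₂[k] k = sym (r₂-bijection _ (+ p ⋆_) into injective onto)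
      where
      P : ℤ
      P = + p
      +[p*[p*k]] : + (p ℕ.* (p ℕ.* k)) ≡ P * (P * + k)
      +[p*[p*k]] = trans (pos-* p (p ℕ.* k)) (cong (P *_) (pos-* p k))
      norm-p⋆ : ∀ w → norm (P ⋆ w) ≡ P * (P * norm w)
      norm-p⋆ (u , v) = identity P u v
        where
        identity : ∀ c u v → c * u * (c * u) + c * v * (c * v) ≡ c * (c * (u * u + v * v))
        identity = solve-∀
      into : ∀ {w} → norm w ≡ + k → norm (P ⋆ w) ≡ + (p ℕ.* (p ℕ.* k)) × P ∣ proj₁ (P ⋆ w) × P ∣ proj₂ (P ⋆ w)
      into {u , v} nw = trans (norm-p⋆ (u , v)) (trans (cong (λ n → P * (P * n)) nw) (sym +[p*[p*k]])) ,
                        ∣m⇒∣m*n u ∣-refl , ∣m⇒∣m*n v ∣-refl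
      injective : ∀ {w w′} → norm w ≡ + k → norm w′ ≡ + k → P ⋆ w ≡ P ⋆ w′ → w ≡ w′
      injective _ _ = ⋆-cancel P
      onto : ∀ {z} → norm z ≡ + (p ℕ.* (p ℕ.* k)) → P ∣ proj₁ z × P ∣ proj₂ z → ∃ λ w → norm w ≡ + k × P ⋆ w ≡ z
      onto nz (divides q₁ refl , divides q₂ refl) = (q₁ , q₂) , norm-q , cong₂ _,_ (*-comm P q₁) (*-comm P q₂)
        where
        norm-q : norm (q₁ , q₂) ≡ + k
        norm-q = *-cancelˡ-≡ P _ _ (*-cancelˡ-≡ P _ _ (trans (sym (norm-p⋆ (q₁ , q₂)))
                   (trans (cong norm (cong₂ _,_ (*-comm P q₁) (*-comm P q₂))) (trans nz +[p*[p*k]]))))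

    r₂∣[p*m]≡0 : ∀ {m} → ¬ p ℕ.∣ m → r₂∣ p (p ℕ.* m) ≡ 0
    r₂∣[p*m]≡0 {m} p∤m = cong length (filter-none _ (All.tabulate not-both))
      where
      not-both : ∀ {z} → z ∈ pointsOfNorm (p ℕ.* m) → ¬ (+ p ∣ proj₁ z × + p ∣ proj₂ z)
      not-both z∈ (divides q₁ refl , divides q₂ refl) = p∤m (∣⇒∣ᵤ (divides (norm (q₁ , q₂)) (*-cancelˡ-≡ (+ p) (+ m) _ p*m≡p*[norm*p])))
        where
        p*m≡p*[norm*p] : + p * + m ≡ + p * (norm (q₁ , q₂) * + p)
        p*m≡p*[norm*p] = trans (sym (pos-* p m)) (trans (sym (∈-pointsOfNorm⁻ z∈)) (identity (+ p) q₁ q₂))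
          where
          identity : ∀ c u v → u * c * (u * c) + v * c * (v * c) ≡ c * ((u * u + v * v) * c)
          identity = solve-∀

  -- Every point of norm 2m is a multiple of 1 + i.
  r₂[2*m]≡r₂[m] : ∀ m → r₂ (2 ℕ.* m) ≡ r₂ m
  r₂[2*m]≡r₂[m] m = sym (trans (r₂≡#[p∣Re[h·z]] prime[2] {+ 1 , + 1} refl 2∤1 m) (cong length (filter-all _ (All.tabulate 2∣Re))))
    where
    2∤1 : ¬ + 2 ∣ + 1
    2∤1 2∣1 with ℕ.∣⇒≤ (∣⇒∣ᵤ 2∣1)
    ... | ℕ.s≤s ()
    2∣Re : ∀ {z} → z ∈ pointsOfNorm (2 ℕ.* m) → + 2 ∣ proj₁ ((+ 1 , + 1) · z)
    2∣Re {x , y} z∈ = [ (λ 2∣d → 2∣d) , (λ 2∣d → 2∣d) ]′ (euclid-ℤ prime[2] _ _ 2∣d²)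
      where
      identity : ∀ x y → (+ 1 * x - + 1 * y) * (+ 1 * x - + 1 * y) ≡ (x * x + y * y) - + 2 * (x * y)
      identity = solve-∀
      2∣d² : + 2 ∣ (+ 1 * x - + 1 * y) * (+ 1 * x - + 1 * y)
      2∣d² = subst (+ 2 ∣_) (sym (identity x y))
               (∣m∣n⇒∣m-n (subst (+ 2 ∣_) (sym (∈-pointsOfNorm⁻ z∈)) (+p∣+[p*m] 2 m)) (∣m⇒∣m*n (x * y) ∣-refl))

module FermatTwoSquares where

  open Counting using (length-unique-⇔; fixedPoints; involution-parity)
  open import Data.Nat using (ℕ; suc; _+_; _*_; _∸_; z≤n; s≤s; _≤_; _<_; _<?_; _≟_; nonTrivial⇒n>1; >-nonZero)
  open import Data.Nat.Properties as ℕ using (even≢odd)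
  open import Data.Nat.Tactic.RingSolver using (solve-∀)
  open import Data.Nat.Primality using (Prime; prime⇒irreducible; prime⇒nonZero; prime⇒nonTrivial)
  open import Data.Nat.Divisibility using (divides)
  open import Data.List using (List; []; _∷_; length; filter; upTo; cartesianProduct)
  open import Data.List.Membership.Propositional using (_∈_)
  open import Data.List.Membership.Propositional.Properties using (∈-filter⁺; ∈-filter⁻; ∈-upTo⁺; ∈-cartesianProduct⁺)
  open import Data.List.Relation.Unary.Any using (here)
  open import Data.List.Relation.Unary.AllPairs using ([]; _∷_)
  import Data.List.Relation.Unary.All as All
  open import Data.List.Relation.Unary.Unique.Propositional using (Unique)
  import Data.List.Relation.Unary.Unique.Propositional.Properties as Unique
  open import Data.Product using (_×_; _,_; proj₁; proj₂; ∃; ∃₂)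
  open import Data.Product.Properties using (≡-dec)
  open import Data.Sum using (inj₁; inj₂)
  open import Data.Empty using (⊥-elim)
  open import Function.Base using (_∘_)
  open import Function.Bundles using (mk⇔)
  open import Relation.Nullary using (¬_; Dec; yes; no)
  open import Relation.Nullary.Decidable using (_×-dec_)
  open import Relation.Unary using (Decidable)
  open import Relation.Binary.Definitions using (DecidableEquality)
  open import Relation.Binary.PropositionalEquality using (_≡_; _≢_; refl; sym; trans; cong; cong₂; subst; module ≡-Reasoning)

  Triple : Set
  Triple = ℕ × ℕ × ℕ

  _≟₃_ : DecidableEquality Triple
  _≟₃_ = ≡-dec _≟_ (≡-dec _≟_ _≟_)

  swap : Triple → Triple
  swap (x , y , z) = (x , z , y)

  zagier : Triple → Triple
  zagier (x , y , z) with x + z <? y | x <? 2 * y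
  ... | yes _ | _     = (x + 2 * z , z , y ∸ (x + z))
  ... | no _  | yes _ = (2 * y ∸ x , y , x + z ∸ y)
  ... | no _  | no _  = (x ∸ 2 * y , x ∸ y + z , y)

  zagier-≡₁ : ∀ {x y z} → x + z < y → zagier (x , y , z) ≡ (x + 2 * z , z , y ∸ (x + z))
  zagier-≡₁ {x} {y} {z} lt with x + z <? y | x <? 2 * y
  ... | yes _  | _ = refl
  ... | no ¬lt | _ = ⊥-elim (¬lt lt)

  zagier-≡₂ : ∀ {x y z} → ¬ x + z < y → x < 2 * y → zagier (x , y , z) ≡ (2 * y ∸ x , y , x + z ∸ y)
  zagier-≡₂ {x} {y} {z} ¬lt₁ lt₂ with x + z <? y | x <? 2 * y
  ... | yes lt₁ | _      = ⊥-elim (¬lt₁ lt₁)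
  ... | no _    | yes _  = refl
  ... | no _    | no ¬lt₂ = ⊥-elim (¬lt₂ lt₂)

  zagier-≡₃ : ∀ {x y z} → ¬ x + z < y → ¬ x < 2 * y → zagier (x , y , z) ≡ (x ∸ 2 * y , x ∸ y + z , y)
  zagier-≡₃ {x} {y} {z} ¬lt₁ ¬lt₂ with x + z <? y | x <? 2 * y
  ... | yes lt₁ | _      = ⊥-elim (¬lt₁ lt₁)
  ... | no _    | yes lt₂ = ⊥-elim (¬lt₂ lt₂)
  ... | no _    | no _   = refl

  private
    d+e≡y+z : ∀ x y z d e → x + z ≡ y + d → x + e ≡ 2 * y → d + e ≡ y + z
    d+e≡y+z x y z d e x+z≡y+d x+e≡2y =
      ℕ.+-cancelʳ-≡ (x + y) (d + e) (y + z) (trans (identity₁ d e x y) (trans (cong₂ _+_ (sym x+z≡y+d) x+e≡2y) (identity₂ x y z)))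
      where
      identity₁ : ∀ d e x y → (d + e) + (x + y) ≡ (y + d) + (x + e)
      identity₁ = solve-∀
      identity₂ : ∀ x y z → (x + z) + 2 * y ≡ (y + z) + (x + y)
      identity₂ = solve-∀

    -- In the middle branch (x , y , z) ↦ (e , y , d); both norms plus 4 y e equal e² + 4 y (y + z).
    middle-branch-norm : ∀ x y z d e → x + z ≡ y + d → x + e ≡ 2 * y → e * e + 4 * (y * d) ≡ x * x + 4 * (y * z)
    middle-branch-norm x y z d e x+z≡y+d x+e≡2y = ℕ.+-cancelʳ-≡ (4 * (y * e)) _ _ (trans lhs (sym rhs))
      where
      open ≡-Reasoning
      lhs : e * e + 4 * (y * d) + 4 * (y * e) ≡ e * e + 4 * (y * (y + z))
      lhs = begin
        e * e + 4 * (y * d) + 4 * (y * e)     ≡⟨ identity e d y ⟩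
        e * e + 4 * (y * (d + e))             ≡⟨ cong (λ w → e * e + 4 * (y * w)) (d+e≡y+z x y z d e x+z≡y+d x+e≡2y) ⟩
        e * e + 4 * (y * (y + z))             ∎
        where
        identity : ∀ e d y → e * e + 4 * (y * d) + 4 * (y * e) ≡ e * e + 4 * (y * (d + e))
        identity = solve-∀
      rhs : x * x + 4 * (y * z) + 4 * (y * e) ≡ e * e + 4 * (y * (y + z))
      rhs = begin
        x * x + 4 * (y * z) + 4 * (y * e)       ≡⟨ identity₁ x y z e ⟩
        x * x + 4 * (y * z) + 2 * e * (2 * y)   ≡⟨ cong (λ w → x * x + 4 * (y * z) + 2 * e * w) (sym x+e≡2y) ⟩
        x * x + 4 * (y * z) + 2 * e * (x + e)   ≡⟨ identity₂ x y z e ⟩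
        (x + e) * (x + e) + e * e + 4 * (y * z) ≡⟨ cong (λ w → w * w + e * e + 4 * (y * z)) x+e≡2y ⟩
        2 * y * (2 * y) + e * e + 4 * (y * z)   ≡⟨ identity₃ y z e ⟩
        e * e + 4 * (y * (y + z))               ∎
        where
        identity₁ : ∀ x y z e → x * x + 4 * (y * z) + 4 * (y * e) ≡ x * x + 4 * (y * z) + 2 * e * (2 * y)
        identity₁ = solve-∀
        identity₂ : ∀ x y z e → x * x + 4 * (y * z) + 2 * e * (x + e) ≡ (x + e) * (x + e) + e * e + 4 * (y * z)
        identity₂ = solve-∀
        identity₃ : ∀ y z e → 2 * y * (2 * y) + e * e + 4 * (y * z) ≡ e * e + 4 * (y * (y + z))
        identity₃ = solve-∀

  module _ {p k : ℕ} (p-prime : Prime p) (p≡1+4k : p ≡ 1 + 4 * k) where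

    Windmill : Triple → Set
    Windmill (x , y , z) = 0 < x × 0 < y × 0 < z × x * x + 4 * (y * z) ≡ p

    windmill? : Decidable Windmill
    windmill? (x , y , z) = 0 <? x ×-dec 0 <? y ×-dec 0 <? z ×-dec x * x + 4 * (y * z) ≟ p

    private
      1<p : 1 < p
      1<p = nonTrivial⇒n>1 p {{prime⇒nonTrivial p-prime}}

      a*a≢p : ∀ a → a * a ≢ p
      a*a≢p a a*a≡p with prime⇒irreducible p-prime (divides a (sym a*a≡p))
      ... | inj₁ refl = ℕ.<-irrefl a*a≡p 1<p
      ... | inj₂ refl = ℕ.<-irrefl (sym (ℕ.*-cancelˡ-≡ a 1 a {{prime⇒nonZero p-prime}} (trans a*a≡p (sym (ℕ.*-identityʳ a))))) 1<p

      2*m≢p : ∀ m → 2 * m ≢ p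
      2*m≢p m 2m≡p = even≢odd m (2 * k) (trans 2m≡p (trans p≡1+4k (cong suc (identity k))))
        where
        identity : ∀ k → 4 * k ≡ 2 * (2 * k)
        identity = solve-∀

    ZagierBehavesAt : Triple → Set
    ZagierBehavesAt t = Windmill (zagier t) × zagier (zagier t) ≡ t × (zagier t ≡ t → t ≡ (1 , 1 , k))

    private
      ≤-witness : ∀ {a b} c → a + c ≡ b → a ≤ b
      ≤-witness {a} c a+c≡b = subst (a ≤_) a+c≡b (ℕ.m≤m+n a c)

      -- The three branches of zagier, each with its parameters chosen so that no truncated subtraction remains.
      behaves₁ : ∀ x z o → let t = (x , x + z + suc o , z) in Windmill t → ZagierBehavesAt t
      behaves₁ x z o (0<x , _ , 0<z , eq) = windmill , involutive , fixed
        where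
        y : ℕ
        y = x + z + suc o
        zagier-t : zagier (x , y , z) ≡ (x + 2 * z , z , suc o)
        zagier-t = trans (zagier-≡₁ (ℕ.m<m+n (x + z) (s≤s z≤n))) (cong (λ w → (x + 2 * z , z , w)) (ℕ.m+n∸m≡n (x + z) (suc o)))
        identity : ∀ x z d → (x + 2 * z) * (x + 2 * z) + 4 * (z * d) ≡ x * x + 4 * ((x + z + d) * z)
        identity = solve-∀
        windmill : Windmill (zagier (x , y , z))
        windmill = subst Windmill (sym zagier-t) (ℕ.≤-trans 0<x (ℕ.m≤m+n x (2 * z)) , 0<z , s≤s z≤n , trans (identity x z (suc o)) eq)
        shift : ∀ x z d → z + (x + z + d) ≡ x + 2 * z + d
        shift = solve-∀
        x+2z≡[x+z]+z : ∀ x z → x + 2 * z ≡ (x + z) + z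
        x+2z≡[x+z]+z = solve-∀
        zagier-back : zagier (x + 2 * z , z , suc o) ≡ (x , y , z)
        zagier-back = trans (zagier-≡₃ (ℕ.≤⇒≯ (≤-witness (x + z + suc o) (shift x z (suc o)))) (ℕ.≤⇒≯ (ℕ.m≤n+m (2 * z) x)))
          (cong₂ (λ a b → (a , b , z)) (ℕ.m+n∸n≡m x (2 * z)) (cong (_+ suc o) (trans (cong (_∸ z) (x+2z≡[x+z]+z x z)) (ℕ.m+n∸n≡m (x + z) z))))
        involutive : zagier (zagier (x , y , z)) ≡ (x , y , z)
        involutive = trans (cong zagier zagier-t) zagier-back
        fixed : zagier (x , y , z) ≡ (x , y , z) → (x , y , z) ≡ (1 , 1 , k)
        fixed zt≡t = ⊥-elim (ℕ.<-irrefl (sym 2z≡0) (ℕ.≤-trans 0<z (ℕ.m≤m+n z (z + 0))))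
          where
          2z≡0 : 2 * z ≡ 0
          2z≡0 = ℕ.+-cancelˡ-≡ x (2 * z) 0 (trans (cong proj₁ (trans (sym zagier-t) zt≡t)) (sym (ℕ.+-identityʳ x)))

      behaves₂ : ∀ x y z d e → x + z ≡ y + suc d → x + suc e ≡ 2 * y → Windmill (x , y , z) → ZagierBehavesAt (x , y , z)
      behaves₂ x y z d e x+z≡y+D x+E≡2y (0<x , 0<y , 0<z , eq) = windmill , involutive , fixed
        where
        D E : ℕ
        D = suc d
        E = suc e
        zagier-t : zagier (x , y , z) ≡ (E , y , D)
        zagier-t = trans (zagier-≡₂ (ℕ.≤⇒≯ (subst (y ≤_) (sym x+z≡y+D) (ℕ.m≤m+n y D))) (subst (x <_) x+E≡2y (ℕ.m<m+n x (s≤s z≤n))))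
          (cong₂ (λ a b → (a , y , b)) (trans (cong (_∸ x) (sym x+E≡2y)) (ℕ.m+n∸m≡n x E)) (trans (cong (_∸ y) x+z≡y+D) (ℕ.m+n∸m≡n y D)))
        windmill : Windmill (zagier (x , y , z))
        windmill = subst Windmill (sym zagier-t) (s≤s z≤n , 0<y , s≤s z≤n , trans (middle-branch-norm x y z D E x+z≡y+D x+E≡2y) eq)
        zagier-back : zagier (E , y , D) ≡ (x , y , z)
        zagier-back = trans (zagier-≡₂ (ℕ.≤⇒≯ (subst (y ≤_) (sym (trans (ℕ.+-comm E D) (d+e≡y+z x y z D E x+z≡y+D x+E≡2y))) (ℕ.m≤m+n y z))) (subst (E <_) x+E≡2y (ℕ.m<n+m E 0<x)))
          (cong₂ (λ a b → (a , y , b)) (trans (cong (_∸ E) (sym x+E≡2y)) (ℕ.m+n∸n≡m x E)) (trans (cong (_∸ y) (trans (ℕ.+-comm E D) (d+e≡y+z x y z D E x+z≡y+D x+E≡2y))) (ℕ.m+n∸m≡n y z)))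
        involutive : zagier (zagier (x , y , z)) ≡ (x , y , z)
        involutive = trans (cong zagier zagier-t) zagier-back
        x≡y-of : zagier (x , y , z) ≡ (x , y , z) → x ≡ y
        x≡y-of zt≡t = ℕ.*-cancelˡ-≡ x y 2 (trans (cong (x +_) (ℕ.+-identityʳ x)) (trans (cong (x +_) (sym E≡x)) x+E≡2y))
          where
          E≡x : E ≡ x
          E≡x = cong proj₁ (trans (sym zagier-t) zt≡t)
        p≡[x+4z]*x : x ≡ y → p ≡ (x + 4 * z) * x
        p≡[x+4z]*x x≡y = trans (sym eq) (trans (cong (λ w → x * x + 4 * (w * z)) (sym x≡y)) (identity x z))
          where
          identity : ∀ x z → x * x + 4 * (x * z) ≡ (x + 4 * z) * x
          identity = solve-∀
        -- a fixed point has x = y, so x divides p; hence x = 1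
        fixed : zagier (x , y , z) ≡ (x , y , z) → (x , y , z) ≡ (1 , 1 , k)
        fixed zt≡t with prime⇒irreducible p-prime (divides (x + 4 * z) (p≡[x+4z]*x (x≡y-of zt≡t)))
        ... | inj₁ x≡1 = cong₂ _,_ x≡1 (cong₂ _,_ y≡1 z≡k)
          where
          y≡1 : y ≡ 1
          y≡1 = trans (sym (x≡y-of zt≡t)) x≡1
          z≡k : z ≡ k
          z≡k = ℕ.*-cancelˡ-≡ z k 4 (ℕ.suc-injective (trans 1+4z≡p p≡1+4k))
            where
            1+4z≡p : 1 + 4 * z ≡ p
            1+4z≡p = trans (cong (λ w → 1 + 4 * w) (sym (ℕ.*-identityˡ z))) (trans (cong₂ (λ a b → a * a + 4 * (b * z)) (sym x≡1) (sym y≡1)) eq)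
        ... | inj₂ x≡p = ⊥-elim (ℕ.<⇒≱ 1<p (subst (p ≤_) p+4z≡1 (ℕ.m≤m+n p (4 * z))))
          where
          p+4z≡1 : p + 4 * z ≡ 1
          p+4z≡1 = ℕ.*-cancelˡ-≡ (p + 4 * z) 1 p {{prime⇒nonZero p-prime}}
            (trans (cong (λ w → w * (w + 4 * z)) (sym x≡p)) (trans (ℕ.*-comm x (x + 4 * z)) (trans (sym (p≡[x+4z]*x (x≡y-of zt≡t))) (sym (ℕ.*-identityʳ p)))))

      behaves₃ : ∀ y z d → let t = (2 * y + suc d , y , z) in Windmill t → ZagierBehavesAt t
      behaves₃ y z d (_ , 0<y , 0<z , eq) = windmill , involutive , fixed
        where
        x : ℕ
        x = 2 * y + suc d
        shift : ∀ y z d → y + (y + d + z) ≡ 2 * y + d + z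
        shift = solve-∀
        2y+d≡y+[y+d] : ∀ y d → 2 * y + d ≡ y + (y + d)
        2y+d≡y+[y+d] = solve-∀
        zagier-t : zagier (x , y , z) ≡ (suc d , y + suc d + z , y)
        zagier-t = trans (zagier-≡₃ (ℕ.≤⇒≯ (≤-witness (y + suc d + z) (shift y z (suc d)))) (ℕ.≤⇒≯ (ℕ.m≤m+n (2 * y) (suc d))))
          (cong₂ (λ a b → (a , b , y)) (ℕ.m+n∸m≡n (2 * y) (suc d)) (cong (_+ z) (trans (cong (_∸ y) (2y+d≡y+[y+d] y (suc d))) (ℕ.m+n∸m≡n y (y + suc d)))))
        identity : ∀ y z d → d * d + 4 * ((y + d + z) * y) ≡ (2 * y + d) * (2 * y + d) + 4 * (y * z)
        identity = solve-∀
        windmill : Windmill (zagier (x , y , z))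
        windmill = subst Windmill (sym zagier-t) (s≤s z≤n , ℕ.≤-trans 0<y (ℕ.≤-trans (ℕ.m≤m+n y (suc d)) (ℕ.m≤m+n (y + suc d) z)) , 0<y , trans (identity y z (suc d)) eq)
        y+d+z≡[d+y]+z : ∀ y d z → y + d + z ≡ (d + y) + z
        y+d+z≡[d+y]+z = solve-∀
        zagier-back : zagier (suc d , y + suc d + z , y) ≡ (x , y , z)
        zagier-back = trans (zagier-≡₁ (subst (suc d + y <_) (sym (y+d+z≡[d+y]+z y (suc d) z)) (ℕ.m<m+n (suc d + y) 0<z)))
          (cong₂ (λ a b → (a , y , b)) (ℕ.+-comm (suc d) (2 * y)) (trans (cong (_∸ (suc d + y)) (y+d+z≡[d+y]+z y (suc d) z)) (ℕ.m+n∸m≡n (suc d + y) z)))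
        involutive : zagier (zagier (x , y , z)) ≡ (x , y , z)
        involutive = trans (cong zagier zagier-t) zagier-back
        fixed : zagier (x , y , z) ≡ (x , y , z) → (x , y , z) ≡ (1 , 1 , k)
        fixed zt≡t = ⊥-elim (ℕ.<-irrefl (sym 2y≡0) (ℕ.≤-trans 0<y (ℕ.m≤m+n y (y + 0))))
          where
          2y≡0 : 2 * y ≡ 0
          2y≡0 = sym (ℕ.+-cancelʳ-≡ (suc d) 0 (2 * y) (cong proj₁ (trans (sym zagier-t) zt≡t)))

    -- y = x + z would make p = (x + 2z)², and x = 2y would make p even.
    zagier-behaves : ∀ {t} → Windmill t → ZagierBehavesAt t
    zagier-behaves {x , y , z} w@(_ , _ , _ , eq) = by-branch (x + z <? y) (x <? 2 * y)
      where
      y≢x+z : y ≢ x + z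
      y≢x+z y≡x+z = a*a≢p (x + 2 * z) (trans (sym (identity x z)) (trans (cong (λ w → x * x + 4 * (w * z)) (sym y≡x+z)) eq))
        where
        identity : ∀ x z → x * x + 4 * ((x + z) * z) ≡ (x + 2 * z) * (x + 2 * z)
        identity = solve-∀
      2y≢x : 2 * y ≢ x
      2y≢x 2y≡x = 2*m≢p (2 * (y * y + y * z)) (trans (sym (identity y z)) (trans (cong (λ w → w * w + 4 * (y * z)) 2y≡x) eq))
        where
        identity : ∀ y z → 2 * y * (2 * y) + 4 * (y * z) ≡ 2 * (2 * (y * y + y * z))
        identity = solve-∀
      by-branch : Dec (x + z < y) → Dec (x < 2 * y) → ZagierBehavesAt (x , y , z)
      by-branch (yes x+z<y) _ with o , x+z+1+o≡y ← ℕ.m≤n⇒∃[o]m+o≡n x+z<y =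
        subst (λ y → Windmill (x , y , z) → ZagierBehavesAt (x , y , z)) (trans (ℕ.+-suc (x + z) o) x+z+1+o≡y) (behaves₁ x z o) w
      by-branch (no x+z≮y) (yes x<2y)
        with d , y+1+d≡x+z ← ℕ.m≤n⇒∃[o]m+o≡n (ℕ.≤∧≢⇒< (ℕ.≮⇒≥ x+z≮y) y≢x+z)
           | e , x+1+e≡2y ← ℕ.m≤n⇒∃[o]m+o≡n x<2y =
        behaves₂ x y z d e (trans (sym y+1+d≡x+z) (sym (ℕ.+-suc y d))) (trans (ℕ.+-suc x e) x+1+e≡2y) w
      by-branch (no x+z≮y) (no x≮2y) with d , 2y+1+d≡x ← ℕ.m≤n⇒∃[o]m+o≡n (ℕ.≤∧≢⇒< (ℕ.≮⇒≥ x≮2y) 2y≢x) =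
        subst (λ x → Windmill (x , y , z) → ZagierBehavesAt (x , y , z)) (trans (ℕ.+-suc (2 * y) d) 2y+1+d≡x) (behaves₃ y z d) w

    private
      cube : List Triple
      cube = cartesianProduct (upTo (suc p)) (cartesianProduct (upTo (suc p)) (upTo (suc p)))

      windmill⇒∈cube : ∀ {t} → Windmill t → t ∈ cube
      windmill⇒∈cube {x , y , z} (0<x , 0<y , 0<z , eq) =
        ∈-cartesianProduct⁺ (∈-upTo⁺ (s≤s x≤p)) (∈-cartesianProduct⁺ (∈-upTo⁺ (s≤s y≤p)) (∈-upTo⁺ (s≤s z≤p)))
        where
        x≤p : x ≤ p
        x≤p = ℕ.≤-trans (ℕ.m≤m*n x x {{>-nonZero 0<x}}) (subst (x * x ≤_) eq (ℕ.m≤m+n (x * x) _))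
        yz≤p : y * z ≤ p
        yz≤p = ℕ.≤-trans (ℕ.m≤n*m (y * z) 4) (subst (4 * (y * z) ≤_) eq (ℕ.m≤n+m _ (x * x)))
        y≤p : y ≤ p
        y≤p = ℕ.≤-trans (ℕ.m≤m*n y z {{>-nonZero 0<z}}) yz≤p
        z≤p : z ≤ p
        z≤p = ℕ.≤-trans (ℕ.m≤n*m z y {{>-nonZero 0<y}}) yz≤p

      windmills : List Triple
      windmills = filter windmill? cube

      windmills-unique : Unique windmills
      windmills-unique = Unique.filter⁺ windmill? (Unique.cartesianProduct⁺ (Unique.upTo⁺ (suc p)) (Unique.cartesianProduct⁺ (Unique.upTo⁺ (suc p)) (Unique.upTo⁺ (suc p))))

      ∈-windmills⁺ : ∀ {t} → Windmill t → t ∈ windmills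
      ∈-windmills⁺ w = ∈-filter⁺ windmill? (windmill⇒∈cube w) w

      ∈-windmills⁻ : ∀ {t} → t ∈ windmills → Windmill t
      ∈-windmills⁻ t∈ = proj₂ (∈-filter⁻ windmill? {xs = cube} t∈)

      zagier-parity : ∃ λ n → length windmills ≡ 2 * n + length (fixedPoints _≟₃_ zagier windmills)
      zagier-parity = involution-parity _≟₃_ zagier windmills-unique
        (λ t∈ → ∈-windmills⁺ (proj₁ (zagier-behaves (∈-windmills⁻ t∈))))
        (λ t∈ → proj₁ (proj₂ (zagier-behaves (∈-windmills⁻ t∈))))

      0<k : 0 < k
      0<k = ℕ.n≢0⇒n>0 λ k≡0 → ℕ.<-irrefl (sym (trans p≡1+4k (cong (λ k → 1 + 4 * k) k≡0))) 1<p

      zagier-fixedPoints : length (fixedPoints _≟₃_ zagier windmills) ≡ 1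
      zagier-fixedPoints = length-unique-⇔ (Unique.filter⁺ (λ t → zagier t ≟₃ t) windmills-unique) (All.[] ∷ []) (mk⇔ to from)
        where
        windmill-1-1-k : Windmill (1 , 1 , k)
        windmill-1-1-k = s≤s z≤n , s≤s z≤n , 0<k , trans (cong (λ w → 1 + 4 * w) (ℕ.*-identityˡ k)) (sym p≡1+4k)
        to : ∀ {t} → t ∈ fixedPoints _≟₃_ zagier windmills → t ∈ (1 , 1 , k) ∷ []
        to t∈ with t∈W , zt≡t ← ∈-filter⁻ (λ t → zagier t ≟₃ t) {xs = windmills} t∈ = here (proj₂ (proj₂ (zagier-behaves (∈-windmills⁻ t∈W))) zt≡t)
        from : ∀ {t} → t ∈ (1 , 1 , k) ∷ [] → t ∈ fixedPoints _≟₃_ zagier windmills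
        from (here refl) = ∈-filter⁺ (λ t → zagier t ≟₃ t) (∈-windmills⁺ windmill-1-1-k) (zagier-≡₂ (λ { (s≤s ()) }) (s≤s (s≤s z≤n)))

    -- zagier has exactly one fixed point, so there is an odd number of windmills and swap must have a fixed point.
    fermat-two-squares : ∃₂ λ a b → 0 < a × 0 < b × a * a + b * b ≡ p
    fermat-two-squares with fixedPoints _≟₃_ swap windmills in swap-fixed≡
    ... | [] = ⊥-elim (even≢odd n₂ n₁ (trans (sym (trans len₂ (ℕ.+-identityʳ _))) (trans len₁ (ℕ.+-comm _ 1))))
      where
      n₁ : ℕ
      n₁ = proj₁ zagier-parity
      len₁ : length windmills ≡ 2 * n₁ + 1
      len₁ = trans (proj₂ zagier-parity) (cong (2 * n₁ +_) zagier-fixedPoints)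
      swap-parity : ∃ λ n → length windmills ≡ 2 * n + length (fixedPoints _≟₃_ swap windmills)
      swap-parity = involution-parity _≟₃_ swap windmills-unique
        (λ { {x , y , z} t∈ → let 0<x , 0<y , 0<z , eq = ∈-windmills⁻ t∈ in ∈-windmills⁺ (0<x , 0<z , 0<y , trans (cong (λ w → x * x + 4 * w) (ℕ.*-comm z y)) eq) })
        (λ _ → refl)
      n₂ : ℕ
      n₂ = proj₁ swap-parity
      len₂ : length windmills ≡ 2 * n₂ + 0
      len₂ = trans (proj₂ swap-parity) (cong (λ fs → 2 * n₂ + length fs) swap-fixed≡)
    ... | (x , y , z) ∷ _ with t∈W , swap-t≡t ← ∈-filter⁻ (λ t → swap t ≟₃ t) {xs = windmills} (subst ((x , y , z) ∈_) (sym swap-fixed≡) (here refl)) =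
      let 0<x , 0<y , _ , eq = ∈-windmills⁻ t∈W in
      x , 2 * y , 0<x , ℕ.*-monoʳ-< 2 0<y , trans (identity x y) (trans (cong (λ w → x * x + 4 * (y * w)) (sym (cong (proj₁ ∘ proj₂) swap-t≡t))) eq)
      where
      identity : ∀ x y → x * x + 2 * y * (2 * y) ≡ x * x + 4 * (y * y)
      identity = solve-∀

module NonResidue where

  open Counting using (fixedPoints; involution-parity)
  open DivisorSums using (∤-prime⇒coprime)
  open GaussianCounts using (euclid-ℤ; ∣-cancelˡ-*)
  open LatticePoints using (x*x≡∣x∣²)
  open import Data.Nat as ℕ using (ℕ; zero; suc; z≤n; s≤s; _⊓_; _∸_)
  import Data.Nat.Properties as ℕ
  import Data.Nat.Divisibility as ℕ
  import Data.Nat.Tactic.RingSolver as ℕ-Solver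
  open import Data.Nat.Primality using (Prime; prime⇒nonZero)
  open import Data.Nat.Coprimality using (coprime-Bézout)
  open import Data.Nat.GCD using (module Bézout)
  open import Data.Integer using (ℤ; +_; -_; _+_; _-_; _*_; _%_; _/_; NonZero) renaming (∣_∣ to abs)
  open import Data.Integer.Properties using (pos-*; pos-+; neg-distribˡ-*; +-inverseʳ; [+m]-[+n]≡m⊖n; ⊖-≥)
  open import Data.Integer.DivMod using (a≡a%n+[a/n]*n; n%d<d)
  open import Data.Integer.Divisibility.Signed using (_∣_; _∣?_; divides; ∣⇒∣ᵤ; ∣ᵤ⇒∣; ∣m∣n⇒∣m+n; ∣m∣n⇒∣m-n; ∣n⇒∣m*n; ∣m⇒∣m*n; ∣-refl; ∣m⇒∣-m)
  open import Data.Integer.Tactic.RingSolver using (solve-∀)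
  open import Data.List using (List; []; length; map; upTo)
  open import Data.List.Properties using (length-map; length-upTo; filter-none)
  open import Data.List.Membership.Propositional using (_∈_)
  open import Data.List.Membership.Propositional.Properties using (∈-map⁺; ∈-map⁻; ∈-upTo⁺; ∈-upTo⁻)
  import Data.List.Relation.Unary.All as All
  import Data.List.Relation.Unary.Unique.Propositional.Properties as Unique
  open import Data.Product using (_×_; _,_; proj₁; proj₂; ∃)
  open import Data.Sum using (inj₁; inj₂; [_,_]′)
  open import Data.Empty using (⊥-elim)
  open import Relation.Nullary using (¬_; yes; no)
  open import Relation.Binary.PropositionalEquality using (_≡_; _≢_; refl; sym; trans; cong; cong₂; subst; module ≡-Reasoning)

  module _ {p k : ℕ} (p-prime : Prime p) (p≡3+4k : p ≡ 3 ℕ.+ 4 ℕ.* k) where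

    private
      P : ℤ
      P = + p

      instance
        P≢0 : NonZero P
        P≢0 = prime⇒nonZero p-prime

      h : ℕ
      h = suc (2 ℕ.* k)

      p≡2h+1 : p ≡ suc (2 ℕ.* h)
      p≡2h+1 = trans p≡3+4k (identity k)
        where
        identity : ∀ k → 3 ℕ.+ 4 ℕ.* k ≡ suc (2 ℕ.* suc (2 ℕ.* k))
        identity = ℕ-Solver.solve-∀

      infix 4 _≡±_
      data _≡±_ (a b : ℤ) : Set where
        equal    : P ∣ a - b → a ≡± b
        opposite : P ∣ a + b → a ≡± b

      ≡±-trans : ∀ {a b c} → a ≡± b → b ≡± c → a ≡± c
      ≡±-trans {a} {b} {c} (equal p∣a-b) (equal p∣b-c) = equal (subst (P ∣_) (identity a b c) (∣m∣n⇒∣m+n p∣a-b p∣b-c))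
        where
        identity : ∀ a b c → (a - b) + (b - c) ≡ a - c
        identity = solve-∀
      ≡±-trans {a} {b} {c} (equal p∣a-b) (opposite p∣b+c) = opposite (subst (P ∣_) (identity a b c) (∣m∣n⇒∣m+n p∣a-b p∣b+c))
        where
        identity : ∀ a b c → (a - b) + (b + c) ≡ a + c
        identity = solve-∀
      ≡±-trans {a} {b} {c} (opposite p∣a+b) (equal p∣b-c) = opposite (subst (P ∣_) (identity a b c) (∣m∣n⇒∣m-n p∣a+b p∣b-c))
        where
        identity : ∀ a b c → (a + b) - (b - c) ≡ a + c
        identity = solve-∀
      ≡±-trans {a} {b} {c} (opposite p∣a+b) (opposite p∣b+c) = equal (subst (P ∣_) (identity a b c) (∣m∣n⇒∣m-n p∣a+b p∣b+c))
        where
        identity : ∀ a b c → (a + b) - (b + c) ≡ a - c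
        identity = solve-∀

      ≡±-*ˡ : ∀ c {a b} → a ≡± b → c * a ≡± c * b
      ≡±-*ˡ c {a} {b} (equal p∣a-b) = equal (subst (P ∣_) (identity a b c) (∣n⇒∣m*n c p∣a-b))
        where
        identity : ∀ a b c → c * (a - b) ≡ c * a - c * b
        identity = solve-∀
      ≡±-*ˡ c {a} {b} (opposite p∣a+b) = opposite (subst (P ∣_) (identity a b c) (∣n⇒∣m*n c p∣a+b))
        where
        identity : ∀ a b c → c * (a + b) ≡ c * a + c * b
        identity = solve-∀

      ≡±-neg : ∀ {a b} → a ≡± - b → a ≡± b
      ≡±-neg {a} {b} (equal p∣a--b) = opposite (subst (P ∣_) (identity a b) p∣a--b)
        where
        identity : ∀ a b → a - - b ≡ a + b
        identity = solve-∀
      ≡±-neg {a} {b} (opposite p∣a+-b) = equal (subst (P ∣_) (identity a b) p∣a+-b)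
        where
        identity : ∀ a b → a + - b ≡ a - b
        identity = solve-∀

      p∣n<p⇒n≡0 : ∀ {n} → P ∣ + n → n ℕ.< p → n ≡ 0
      p∣n<p⇒n≡0 {zero} _ _ = refl
      p∣n<p⇒n≡0 {suc n} p∣n n<p = ⊥-elim (ℕ.<⇒≱ n<p (ℕ.∣⇒≤ (∣⇒∣ᵤ p∣n)))

      InRange : ℕ → Set
      InRange t = 0 ℕ.< t × t ℕ.≤ h

      h<p : h ℕ.< p
      h<p = subst (h ℕ.<_) (sym p≡2h+1) (s≤s (ℕ.m≤m+n h (h ℕ.+ 0)))

      p∤InRange : ∀ {t} → InRange t → ¬ P ∣ + t
      p∤InRange (0<t , t≤h) p∣t with p∣n<p⇒n≡0 p∣t (ℕ.≤-<-trans t≤h h<p)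
      p∤InRange (() , _) _ | refl

      p∣n-m⇒n≡m : ∀ {m n} → m ℕ.≤ n → n ℕ.< p → P ∣ + n - + m → n ≡ m
      p∣n-m⇒n≡m {m} {n} m≤n n<p p∣n-m = ℕ.≤-antisym (ℕ.m∸n≡0⇒m≤n n∸m≡0) m≤n
        where
        n∸m≡0 : n ∸ m ≡ 0
        n∸m≡0 = p∣n<p⇒n≡0 (subst (P ∣_) (trans ([+m]-[+n]≡m⊖n n m) (⊖-≥ m≤n)) p∣n-m) (ℕ.≤-<-trans (ℕ.m∸n≤m n m) n<p)

      ≡±⇒≡ : ∀ {a b} → InRange a → InRange b → + a ≡± + b → a ≡ b
      ≡±⇒≡ {a} {b} (_ , a≤h) (_ , b≤h) (equal p∣a-b) with ℕ.≤-total a b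
      ... | inj₁ a≤b = sym (p∣n-m⇒n≡m a≤b (ℕ.≤-<-trans b≤h h<p) (subst (P ∣_) (identity (+ a) (+ b)) (∣m⇒∣-m p∣a-b)))
        where
        identity : ∀ a b → - (a - b) ≡ b - a
        identity = solve-∀
      ... | inj₂ b≤a = p∣n-m⇒n≡m b≤a (ℕ.≤-<-trans a≤h h<p) p∣a-b
      ≡±⇒≡ {a} {b} (0<a , a≤h) (_ , b≤h) (opposite p∣a+b) = ⊥-elim (ℕ.<⇒≢ (ℕ.≤-trans 0<a (ℕ.m≤m+n a b)) (sym (p∣n<p⇒n≡0 (subst (P ∣_) (sym (pos-+ a b)) p∣a+b) a+b<p)))
        where
        a+b<p : a ℕ.+ b ℕ.< p
        a+b<p = subst (a ℕ.+ b ℕ.<_) (sym p≡2h+1) (s≤s (ℕ.+-mono-≤ a≤h (subst (b ℕ.≤_) (sym (ℕ.+-identityʳ h)) b≤h)))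

      p∤1 : ¬ P ∣ + 1
      p∤1 p∣1 = ℕ.<⇒≱ (subst (1 ℕ.<_) (sym p≡3+4k) (s≤s (s≤s z≤n))) (ℕ.∣⇒≤ (∣⇒∣ᵤ p∣1))

      p∤2 : ¬ P ∣ + 2
      p∤2 p∣2 = ℕ.<⇒≱ (subst (2 ℕ.<_) (sym p≡3+4k) (s≤s (s≤s (s≤s z≤n)))) (ℕ.∣⇒≤ (∣⇒∣ᵤ p∣2))

      fold : ℕ → ℕ
      fold r = r ⊓ (p ∸ r)

      fold≡± : ∀ {r} → r ℕ.≤ p → + fold r ≡± + r
      fold≡± {r} r≤p with ℕ.⊓-sel r (p ∸ r)
      ... | inj₁ fold≡r = equal (subst (λ x → P ∣ + x - + r) (sym fold≡r) (divides (+ 0) (+-inverseʳ (+ r))))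
      ... | inj₂ fold≡p∸r = opposite (subst (λ x → P ∣ + x + + r) (sym fold≡p∸r) (subst (P ∣_) p≡[p∸r]+r ∣-refl))
        where
        p≡[p∸r]+r : P ≡ + (p ∸ r) + + r
        p≡[p∸r]+r = trans (cong +_ (sym (ℕ.m∸n+n≡m r≤p))) (pos-+ (p ∸ r) r)

      fold-InRange : ∀ {r} → 0 ℕ.< r → r ℕ.< p → InRange (fold r)
      fold-InRange {r} 0<r r<p = ℕ.⊓-glb 0<r (ℕ.m<n⇒0<n∸m r<p) , fold≤h
        where
        fold≤h : fold r ℕ.≤ h
        fold≤h with ℕ.≤-total r h
        ... | inj₁ r≤h = ℕ.≤-trans (ℕ.m⊓n≤m r (p ∸ r)) r≤h
        ... | inj₂ h≤r with ℕ.m≤n⇒m<n∨m≡n h≤r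
        ...   | inj₂ refl = ℕ.≤-trans (ℕ.m⊓n≤m r (p ∸ r)) ℕ.≤-refl
        ...   | inj₁ h<r = ℕ.≤-trans (ℕ.m⊓n≤n r (p ∸ r)) (ℕ.≤-trans (ℕ.∸-monoʳ-≤ p h<r) (ℕ.≤-reflexive p∸[1+h]≡h))
          where
          p∸[1+h]≡h : p ∸ suc h ≡ h
          p∸[1+h]≡h = trans (cong (_∸ suc h) p≡2h+1) (trans (cong (λ n → suc (h ℕ.+ n) ∸ suc h) (ℕ.+-identityʳ h)) (ℕ.m+n∸m≡n h h))

    -- With s² ≡ -1 (mod p), t ↦ ± s t is a fixed-point-free involution of {±1, …, ±h}, but h is odd.
    ¬[p∣s²+1] : ∀ s → ¬ P ∣ s * s + + 1
    ¬[p∣s²+1] s p∣s²+1 = ℕ.even≢odd n k (trans (sym (ℕ.+-identityʳ (2 ℕ.* n)))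
      (trans (sym (trans (proj₂ parity) (cong (λ fs → 2 ℕ.* n ℕ.+ length fs) no-fixedPoints))) length-range))
      where
      residue : ℕ → ℕ
      residue t = (s * + t) % P
      f : ℕ → ℕ
      f t = fold (residue t)
      p∣residue-s*t : ∀ t → P ∣ + residue t - s * + t
      p∣residue-s*t t = (divides (- (s * + t / P)) (trans (cong (_-_ (+ residue t)) (a≡a%n+[a/n]*n (s * + t) P)) (identity (+ residue t) (s * + t / P) P)))
        where
        identity : ∀ r q c → r - (r + q * c) ≡ - q * c
        identity = solve-∀
      f≡±s*t : ∀ t → + f t ≡± s * + t
      f≡±s*t t = ≡±-trans (fold≡± (ℕ.<⇒≤ (n%d<d (s * + t) P))) (equal (p∣residue-s*t t))
      p∤s : ¬ P ∣ s
      p∤s p∣s = p∤1 (subst (P ∣_) (identity s) (∣m∣n⇒∣m-n p∣s²+1 (∣m⇒∣m*n s p∣s)))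
        where
        identity : ∀ s → s * s + + 1 - s * s ≡ + 1
        identity = solve-∀
      f-InRange : ∀ {t} → InRange t → InRange (f t)
      f-InRange {t} t∈ = fold-InRange (ℕ.n≢0⇒n>0 residue≢0) (n%d<d (s * + t) P)
        where
        residue≢0 : residue t ≢ 0
        residue≢0 r≡0 = [ p∤s , p∤InRange t∈ ]′ (euclid-ℤ p-prime s (+ t) p∣st)
          where
          p∣st : P ∣ s * + t
          p∣st = subst (P ∣_) (identity (s * + t)) (∣m⇒∣-m (subst (λ r → P ∣ + r - s * + t) r≡0 (p∣residue-s*t t)))
            where
            identity : ∀ a → - (+ 0 - a) ≡ a
            identity = solve-∀
      f-involutive : ∀ {t} → InRange t → f (f t) ≡ t
      f-involutive {t} t∈ = ≡±⇒≡ (f-InRange (f-InRange t∈)) t∈ (≡±-neg (≡±-trans (≡±-trans (f≡±s*t (f t)) (≡±-*ˡ s (f≡±s*t t))) s*s*t≡±-t))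
        where
        s*s*t≡±-t : s * (s * + t) ≡± - + t
        s*s*t≡±-t = equal (subst (P ∣_) (identity s (+ t)) (∣m⇒∣m*n (+ t) p∣s²+1))
          where
          identity : ∀ s t → (s * s + + 1) * t ≡ s * (s * t) - - t
          identity = solve-∀
      f-no-fixed : ∀ {t} → InRange t → f t ≢ t
      f-no-fixed {t} t∈ ft≡t with subst (λ x → + x ≡± s * + t) ft≡t (f≡±s*t t)
      ... | equal p∣t-st = p∤2 (subst (P ∣_) (identity s) (∣m∣n⇒∣m+n p∣s²+1 (∣m⇒∣m*n (+ 1 + s) p∣1-s)))
        where
        p∣1-s : P ∣ + 1 - s
        p∣1-s = ∣-cancelˡ-* p-prime (p∤InRange t∈) (subst (P ∣_) (identity′ (+ t) s) p∣t-st)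
          where
          identity′ : ∀ t s → t - s * t ≡ t * (+ 1 - s)
          identity′ = solve-∀
        identity : ∀ s → s * s + + 1 + (+ 1 - s) * (+ 1 + s) ≡ + 2
        identity = solve-∀
      ... | opposite p∣t+st = p∤2 (subst (P ∣_) (identity s) (∣m∣n⇒∣m+n p∣s²+1 (∣m⇒∣m*n (+ 1 - s) p∣1+s)))
        where
        p∣1+s : P ∣ + 1 + s
        p∣1+s = ∣-cancelˡ-* p-prime (p∤InRange t∈) (subst (P ∣_) (identity′ (+ t) s) p∣t+st)
          where
          identity′ : ∀ t s → t + s * t ≡ t * (+ 1 + s)
          identity′ = solve-∀
        identity : ∀ s → s * s + + 1 + (+ 1 + s) * (+ 1 - s) ≡ + 2
        identity = solve-∀
      range : List ℕ
      range = map suc (upTo h)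
      length-range : length range ≡ h
      length-range = trans (length-map suc (upTo h)) (length-upTo h)
      ∈-range⁻ : ∀ {t} → t ∈ range → InRange t
      ∈-range⁻ t∈ with i , i∈ , refl ← ∈-map⁻ suc t∈ = s≤s z≤n , ∈-upTo⁻ i∈
      ∈-range⁺ : ∀ {t} → InRange t → t ∈ range
      ∈-range⁺ {suc i} (_ , s≤s i<h) = ∈-map⁺ suc (∈-upTo⁺ (s≤s i<h))
      parity : ∃ λ n → length range ≡ 2 ℕ.* n ℕ.+ length (fixedPoints ℕ._≟_ f range)
      parity = involution-parity ℕ._≟_ f (Unique.map⁺ ℕ.suc-injective (Unique.upTo⁺ h))
                 (λ t∈ → ∈-range⁺ (f-InRange (∈-range⁻ t∈))) (λ t∈ → f-involutive (∈-range⁻ t∈))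
      n : ℕ
      n = proj₁ parity
      no-fixedPoints : fixedPoints ℕ._≟_ f range ≡ []
      no-fixedPoints = filter-none (λ t → f t ℕ.≟ t) (All.tabulate (λ t∈ → f-no-fixed (∈-range⁻ t∈)))

    private
      inverse-mod-p : ∀ {a} → ¬ p ℕ.∣ a → ∃ λ u → P ∣ u * + a - + 1
      inverse-mod-p {a} p∤a with coprime-Bézout (∤-prime⇒coprime p-prime p∤a)
      ... | Bézout.+- u v 1+vp≡ua = + u , divides (+ v) (begin
        + u * + a - + 1          ≡⟨ cong (_- + 1) (sym (pos-* u a)) ⟩
        + (u ℕ.* a) - + 1        ≡⟨ cong (λ n → + n - + 1) (sym 1+vp≡ua) ⟩
        + (1 ℕ.+ v ℕ.* p) - + 1  ≡⟨ cong (_- + 1) (trans (pos-+ 1 (v ℕ.* p)) (cong (_+_ (+ 1)) (pos-* v p))) ⟩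
        + 1 + + v * P - + 1      ≡⟨ identity (+ v) P ⟩
        + v * P                  ∎)
        where
        open ≡-Reasoning
        identity : ∀ v p → + 1 + v * p - + 1 ≡ v * p
        identity = solve-∀
      ... | Bézout.-+ u v 1+ua≡vp = - + u , divides (- + v) (begin
        - + u * + a - + 1        ≡⟨ identity (+ u) (+ a) ⟩
        - (+ 1 + + u * + a)      ≡⟨ cong (λ n → - (+ 1 + n)) (sym (pos-* u a)) ⟩
        - (+ 1 + + (u ℕ.* a))    ≡⟨ cong -_ (sym (pos-+ 1 (u ℕ.* a))) ⟩
        - + (1 ℕ.+ u ℕ.* a)      ≡⟨ cong (λ n → - + n) 1+ua≡vp ⟩
        - + (v ℕ.* p)            ≡⟨ cong -_ (pos-* v p) ⟩
        - (+ v * P)              ≡⟨ neg-distribˡ-* (+ v) P ⟩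
        - + v * P                ∎)
        where
        open ≡-Reasoning
        identity : ∀ u a → - u * a - + 1 ≡ - (+ 1 + u * a)
        identity = solve-∀

    p∣x²+y²⇒p∣x : ∀ x y → P ∣ x * x + y * y → P ∣ x
    p∣x²+y²⇒p∣x x y p∣x²+y² with P ∣? x
    ... | yes p∣x = p∣x
    ... | no p∤x with u , p∣uX-1 ← inverse-mod-p (λ p∣X → p∤x (∣ᵤ⇒∣ p∣X)) = ⊥-elim (¬[p∣s²+1] (u * Y) p∣[uY]²+1)
      where
      X Y : ℤ
      X = + abs x
      Y = + abs y
      p∣X²+Y² : P ∣ X * X + Y * Y
      p∣X²+Y² = subst (P ∣_) (cong₂ _+_ (trans (x*x≡∣x∣² x) (pos-* (abs x) (abs x))) (trans (x*x≡∣x∣² y) (pos-* (abs y) (abs y)))) p∣x²+y²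
      identity : ∀ u X Y → u * u * (X * X + Y * Y) - (u * X - + 1) * (u * X + + 1) ≡ u * Y * (u * Y) + + 1
      identity = solve-∀
      p∣[uY]²+1 : P ∣ u * Y * (u * Y) + + 1
      p∣[uY]²+1 = subst (P ∣_) (identity u X Y) (∣m∣n⇒∣m-n (∣n⇒∣m*n (u * u) p∣X²+Y²) (∣m⇒∣m*n (u * X + + 1) p∣uX-1))

module TwoSquaresTheorem where

  open import Defs using (χ₄)
  open DivisorSums using (divisorSum; divisorSum∤; divisorSum∣; divisorSum-split; divisorSum-*-prime; divisorSum∣-*-prime; divisorSum∣-∤; χ₄-*; χ₄[1+4k]; χ₄[3+4k])
  open LatticePoints using (r₂; norm)
  open GaussianCounts using (r₂∣; +p∣+[p*m]; r₂[2*m]≡r₂[m]; r₂[p*m]+r₂∣≡2*r₂[m]; r₂≡r₂∣; r₂∣[p*[p*k]]≡r₂[k]; r₂∣[p*m]≡0)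
  open FermatTwoSquares using (fermat-two-squares)
  open NonResidue using (p∣x²+y²⇒p∣x)
  open import Data.Nat as ℕ using (ℕ; suc; NonZero; s≤s; _%_; _/_)
  import Data.Nat.Properties as ℕ
  import Data.Nat.Divisibility as ℕ
  open import Data.Nat.DivMod using (m≡m%n+[m/n]*n; m%n<n)
  open import Data.Nat.Induction using (<-rec)
  open import Data.Nat.ListAction using (product)
  open import Data.Nat.Primality using (Prime; prime[2]; prime⇒irreducible; prime⇒nonZero; prime⇒nonTrivial; productOfPrimes≢0)
  open import Data.Nat.Primality.Factorisation using (factorise; PrimeFactorisation)
  import Data.Nat.Tactic.RingSolver as ℕ-Solver
  open import Data.Integer using (ℤ; +_; -_; _+_; _-_; _*_)
  open import Data.Integer.Properties using (pos-+; pos-*; *-identityˡ)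
  open import Data.Integer.Divisibility.Signed using (_∣_; ∣⇒∣ᵤ)
  open import Data.Integer.Tactic.RingSolver using (solve-∀)
  open import Data.List using (_∷_)
  open import Data.List.Relation.Unary.All using (All; _∷_)
  open import Data.Product using (_,_; ∃)
  open import Data.Sum using (_⊎_; inj₁; inj₂)
  open import Relation.Nullary using (¬_; yes; no)
  open import Relation.Binary.PropositionalEquality using (_≡_; refl; sym; trans; cong; cong₂; subst; module ≡-Reasoning)

  prime-mod-4 : ∀ {p} → Prime p → p ≡ 2 ⊎ (∃ λ k → p ≡ 1 ℕ.+ 4 ℕ.* k) ⊎ (∃ λ k → p ≡ 3 ℕ.+ 4 ℕ.* k)
  prime-mod-4 {p} p-prime = by-residue (p % 4) refl (m%n<n p 4)
    where
    p≡r+4q : p ≡ p % 4 ℕ.+ 4 ℕ.* (p / 4)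
    p≡r+4q = trans (m≡m%n+[m/n]*n p 4) (cong (p % 4 ℕ.+_) (ℕ.*-comm (p / 4) 4))
    even⇒2 : ∀ j → p ≡ 2 ℕ.* j → p ≡ 2
    even⇒2 j p≡2j with prime⇒irreducible p-prime (ℕ.divides j (trans p≡2j (ℕ.*-comm 2 j)))
    ... | inj₂ 2≡p = sym 2≡p
    by-residue : ∀ r → p % 4 ≡ r → r ℕ.< 4 → p ≡ 2 ⊎ (∃ λ k → p ≡ 1 ℕ.+ 4 ℕ.* k) ⊎ (∃ λ k → p ≡ 3 ℕ.+ 4 ℕ.* k)
    by-residue 0 p%4≡0 _ = inj₁ (even⇒2 (2 ℕ.* (p / 4)) (trans p≡r+4q (trans (cong (ℕ._+ 4 ℕ.* (p / 4)) p%4≡0) (identity (p / 4)))))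
      where
      identity : ∀ q → 0 ℕ.+ 4 ℕ.* q ≡ 2 ℕ.* (2 ℕ.* q)
      identity = ℕ-Solver.solve-∀
    by-residue 1 p%4≡1 _ = inj₂ (inj₁ (p / 4 , trans p≡r+4q (cong (ℕ._+ 4 ℕ.* (p / 4)) p%4≡1)))
    by-residue 2 p%4≡2 _ = inj₁ (even⇒2 (1 ℕ.+ 2 ℕ.* (p / 4)) (trans p≡r+4q (trans (cong (ℕ._+ 4 ℕ.* (p / 4)) p%4≡2) (identity (p / 4)))))
      where
      identity : ∀ q → 2 ℕ.+ 4 ℕ.* q ≡ 2 ℕ.* (1 ℕ.+ 2 ℕ.* q)
      identity = ℕ-Solver.solve-∀
    by-residue 3 p%4≡3 _ = inj₂ (inj₂ (p / 4 , trans p≡r+4q (cong (ℕ._+ 4 ℕ.* (p / 4)) p%4≡3)))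
    by-residue (suc (suc (suc (suc _)))) _ (s≤s (s≤s (s≤s (s≤s ()))))

  Jacobi : ℕ → Set
  Jacobi n = + r₂ n ≡ + 4 * divisorSum χ₄ n

  module _ {p : ℕ} (p-prime : Prime p) where

    private
      instance
        p≢0 : NonZero p
        p≢0 = prime⇒nonZero p-prime

    divisorSumχ₄-*-prime : ∀ m .{{_ : NonZero m}} → divisorSum χ₄ (p ℕ.* m) ≡ (divisorSum χ₄ m - divisorSum∣ p χ₄ m) + χ₄ p * divisorSum χ₄ m
    divisorSumχ₄-*-prime m = trans (divisorSum-*-prime p-prime χ₄ (χ₄-* p) m) (cong (_+ χ₄ p * divisorSum χ₄ m) D∤≡D-D∣)
      where
      D∤≡D-D∣ : divisorSum∤ p χ₄ m ≡ divisorSum χ₄ m - divisorSum∣ p χ₄ m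
      D∤≡D-D∣ = trans (x≡[x+y]-y _ _) (cong (_- divisorSum∣ p χ₄ m) (sym (divisorSum-split p χ₄ m)))
        where
        x≡[x+y]-y : ∀ x y → x ≡ (x + y) - y
        x≡[x+y]-y = solve-∀

    module _ {m : ℕ} .{{_ : NonZero m}} (jacobi-m/p : ∀ k → m ≡ p ℕ.* k → Jacobi k) where

      r₂∣≡χ₄*4*divisorSum∣ : χ₄ p * χ₄ p ≡ + 1 → + r₂∣ p (p ℕ.* m) ≡ χ₄ p * (+ 4 * divisorSum∣ p χ₄ m)
      r₂∣≡χ₄*4*divisorSum∣ χ²≡1 with p ℕ.∣? m
      ... | no p∤m = trans (cong +_ (r₂∣[p*m]≡0 p-prime p∤m)) (sym (trans (cong (λ x → χ₄ p * (+ 4 * x)) (divisorSum∣-∤ p-prime χ₄ p∤m)) (identity (χ₄ p))))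
        where
        identity : ∀ c → c * (+ 4 * + 0) ≡ + 0
        identity = solve-∀
      ... | yes p∣m = begin
        + r₂∣ p (p ℕ.* m)                          ≡⟨ cong (λ n → + r₂∣ p (p ℕ.* n)) m≡p*k ⟩
        + r₂∣ p (p ℕ.* (p ℕ.* k))                  ≡⟨ cong +_ (r₂∣[p*[p*k]]≡r₂[k] p-prime k) ⟩
        + r₂ k                                     ≡⟨ jacobi-m/p k m≡p*k ⟩
        + 4 * divisorSum χ₄ k                      ≡⟨ identity (χ₄ p) (divisorSum χ₄ k) χ²≡1 ⟩
        χ₄ p * (+ 4 * (χ₄ p * divisorSum χ₄ k))    ≡⟨ cong (λ x → χ₄ p * (+ 4 * x)) (sym (divisorSum∣-*-prime p-prime χ₄ (χ₄-* p) k {{k≢0}})) ⟩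
        χ₄ p * (+ 4 * divisorSum∣ p χ₄ (p ℕ.* k))  ≡⟨ cong (λ n → χ₄ p * (+ 4 * divisorSum∣ p χ₄ n)) (sym m≡p*k) ⟩
        χ₄ p * (+ 4 * divisorSum∣ p χ₄ m)          ∎
        where
        open ≡-Reasoning
        k : ℕ
        k = ℕ.quotient p∣m
        m≡p*k : m ≡ p ℕ.* k
        m≡p*k = ℕ.m∣n⇒n≡m*quotient p∣m
        k≢0 : NonZero k
        k≢0 = ℕ.quotient≢0 p∣m
        identity : ∀ c x → c * c ≡ + 1 → + 4 * x ≡ c * (+ 4 * (c * x))
        identity c x c²≡1 = trans (sym (*-identityˡ (+ 4 * x))) (trans (cong (λ y → y * (+ 4 * x)) (sym c²≡1)) (rearrange c x))
          where
          rearrange : ∀ c x → c * c * (+ 4 * x) ≡ c * (+ 4 * (c * x))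
          rearrange = solve-∀

      jacobi-*-3mod4 : ∀ {k} → p ≡ 3 ℕ.+ 4 ℕ.* k → Jacobi (p ℕ.* m)
      jacobi-*-3mod4 {k} p≡3+4k = begin
        + r₂ (p ℕ.* m)                                                   ≡⟨ cong +_ (r₂≡r₂∣ p-prime (p∣x²+y²⇒p∣x {k = k} p-prime p≡3+4k) (p ℕ.* m) (+p∣+[p*m] p m)) ⟩
        + r₂∣ p (p ℕ.* m)                                                ≡⟨ r₂∣≡χ₄*4*divisorSum∣ (cong (λ c → c * c) χ₄[p]≡-1) ⟩
        χ₄ p * (+ 4 * divisorSum∣ p χ₄ m)                                ≡⟨ cong (λ c → c * (+ 4 * divisorSum∣ p χ₄ m)) χ₄[p]≡-1 ⟩
        - + 1 * (+ 4 * divisorSum∣ p χ₄ m)                               ≡⟨ identity (divisorSum χ₄ m) (divisorSum∣ p χ₄ m) ⟩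
        + 4 * ((divisorSum χ₄ m - divisorSum∣ p χ₄ m) + - + 1 * divisorSum χ₄ m) ≡⟨ cong (λ c → + 4 * ((divisorSum χ₄ m - divisorSum∣ p χ₄ m) + c * divisorSum χ₄ m)) (sym χ₄[p]≡-1) ⟩
        + 4 * ((divisorSum χ₄ m - divisorSum∣ p χ₄ m) + χ₄ p * divisorSum χ₄ m)   ≡⟨ cong (+ 4 *_) (sym (divisorSumχ₄-*-prime m)) ⟩
        + 4 * divisorSum χ₄ (p ℕ.* m)                                     ∎
        where
        open ≡-Reasoning
        χ₄[p]≡-1 : χ₄ p ≡ - + 1
        χ₄[p]≡-1 = trans (cong χ₄ p≡3+4k) (χ₄[3+4k] k)
        identity : ∀ D D∣ → - + 1 * (+ 4 * D∣) ≡ + 4 * ((D - D∣) + - + 1 * D)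
        identity = solve-∀

      module _ (jacobi-m : Jacobi m) where

        jacobi-*-1mod4 : ∀ {k} → p ≡ 1 ℕ.+ 4 ℕ.* k → Jacobi (p ℕ.* m)
        jacobi-*-1mod4 {k} p≡1+4k with a , b , 0<a , 0<b , a²+b²≡p ← fermat-two-squares {k = k} p-prime p≡1+4k = begin
          + r₂ (p ℕ.* m)                                          ≡⟨ x≡[x+y]-y (+ r₂ (p ℕ.* m)) (+ r₂∣ p (p ℕ.* m)) ⟩
          (+ r₂ (p ℕ.* m) + + r₂∣ p (p ℕ.* m)) - + r₂∣ p (p ℕ.* m) ≡⟨ cong (_- + r₂∣ p (p ℕ.* m)) (trans (sym (pos-+ (r₂ (p ℕ.* m)) (r₂∣ p (p ℕ.* m)))) (trans (cong +_ r₂-sum) (pos-+ (r₂ m) (r₂ m)))) ⟩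
          (+ r₂ m + + r₂ m) - + r₂∣ p (p ℕ.* m)                   ≡⟨ cong₂ (λ x y → (x + x) - y) jacobi-m (r₂∣≡χ₄*4*divisorSum∣ (cong (λ c → c * c) χ₄[p]≡1)) ⟩
          (+ 4 * D + + 4 * D) - χ₄ p * (+ 4 * D∣)                 ≡⟨ cong (λ c → (+ 4 * D + + 4 * D) - c * (+ 4 * D∣)) χ₄[p]≡1 ⟩
          (+ 4 * D + + 4 * D) - + 1 * (+ 4 * D∣)                  ≡⟨ identity D D∣ ⟩
          + 4 * ((D - D∣) + + 1 * D)                              ≡⟨ cong (λ c → + 4 * ((D - D∣) + c * D)) (sym χ₄[p]≡1) ⟩
          + 4 * ((D - D∣) + χ₄ p * D)                             ≡⟨ cong (+ 4 *_) (sym (divisorSumχ₄-*-prime m)) ⟩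
          + 4 * divisorSum χ₄ (p ℕ.* m)                           ∎
          where
          open ≡-Reasoning
          D D∣ : ℤ
          D = divisorSum χ₄ m
          D∣ = divisorSum∣ p χ₄ m
          χ₄[p]≡1 : χ₄ p ≡ + 1
          χ₄[p]≡1 = trans (cong χ₄ p≡1+4k) (χ₄[1+4k] k)
          x≡[x+y]-y : ∀ x y → x ≡ (x + y) - y
          x≡[x+y]-y = solve-∀
          identity : ∀ D D∣ → (+ 4 * D + + 4 * D) - + 1 * (+ 4 * D∣) ≡ + 4 * ((D - D∣) + + 1 * D)
          identity = solve-∀
          p∤ : ∀ {a b} → 0 ℕ.< a → 0 ℕ.< b → a ℕ.* a ℕ.+ b ℕ.* b ≡ p → ¬ + p ∣ + a
          p∤ {a} {b} 0<a 0<b a²+b²≡p p∣a = ℕ.<⇒≱ a<p (ℕ.∣⇒≤ {{ℕ.>-nonZero 0<a}} (∣⇒∣ᵤ p∣a))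
            where
            a<p : a ℕ.< p
            a<p = ℕ.≤-<-trans (ℕ.m≤m*n a a {{ℕ.>-nonZero 0<a}}) (subst (a ℕ.* a ℕ.<_) a²+b²≡p (ℕ.m<m+n (a ℕ.* a) (ℕ.*-mono-< 0<b 0<b)))
          p∤2 : ¬ + p ∣ + 2
          p∤2 p∣2 = ℕ.even≢odd (2 ℕ.* k) 0 (ℕ.suc-injective (trans (cong suc (identity′ k)) (trans (sym p≡1+4k) p≡2)))
            where
            p≡2 : p ≡ 2
            p≡2 = ℕ.≤-antisym (ℕ.∣⇒≤ (∣⇒∣ᵤ p∣2)) (ℕ.nonTrivial⇒n>1 p {{prime⇒nonTrivial p-prime}})
            identity′ : ∀ k → 2 ℕ.* (2 ℕ.* k) ≡ 4 ℕ.* k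
            identity′ = ℕ-Solver.solve-∀
          norm-g : norm (+ a , + b) ≡ + p
          norm-g = trans (cong₂ _+_ (sym (pos-* a a)) (sym (pos-* b b))) (trans (sym (pos-+ (a ℕ.* a) (b ℕ.* b))) (cong +_ a²+b²≡p))
          r₂-sum : r₂ (p ℕ.* m) ℕ.+ r₂∣ p (p ℕ.* m) ≡ r₂ m ℕ.+ r₂ m
          r₂-sum = r₂[p*m]+r₂∣≡2*r₂[m] p-prime norm-g (p∤ 0<a 0<b a²+b²≡p) (p∤ 0<b 0<a (trans (ℕ.+-comm (b ℕ.* b) (a ℕ.* a)) a²+b²≡p)) p∤2 m

  jacobi-*2 : ∀ m .{{_ : NonZero m}} → Jacobi m → Jacobi (2 ℕ.* m)
  jacobi-*2 m jacobi-m = begin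
    + r₂ (2 ℕ.* m)                                                ≡⟨ cong +_ (r₂[2*m]≡r₂[m] m) ⟩
    + r₂ m                                                        ≡⟨ jacobi-m ⟩
    + 4 * divisorSum χ₄ m                                         ≡⟨ cong (+ 4 *_) (identity (divisorSum χ₄ m)) ⟩
    + 4 * ((divisorSum χ₄ m - + 0) + χ₄ 2 * divisorSum χ₄ m)       ≡⟨ cong (λ x → + 4 * ((divisorSum χ₄ m - x) + χ₄ 2 * divisorSum χ₄ m)) (sym D∣≡0) ⟩
    + 4 * ((divisorSum χ₄ m - divisorSum∣ 2 χ₄ m) + χ₄ 2 * divisorSum χ₄ m) ≡⟨ cong (+ 4 *_) (sym (divisorSumχ₄-*-prime prime[2] m)) ⟩
    + 4 * divisorSum χ₄ (2 ℕ.* m)                                 ∎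
    where
    open ≡-Reasoning
    identity : ∀ D → D ≡ (D - + 0) + + 0 * D
    identity = solve-∀
    D∣≡0 : divisorSum∣ 2 χ₄ m ≡ + 0
    D∣≡0 with 2 ℕ.∣? m
    ... | no 2∤m = divisorSum∣-∤ prime[2] χ₄ 2∤m
    ... | yes 2∣m = trans (cong (divisorSum∣ 2 χ₄) (ℕ.m∣n⇒n≡m*quotient 2∣m))
                          (divisorSum∣-*-prime prime[2] χ₄ (χ₄-* 2) (ℕ.quotient 2∣m) {{ℕ.quotient≢0 2∣m}})

  jacobi-*-prime : ∀ {p} → Prime p → ∀ m .{{_ : NonZero m}} → Jacobi m → (∀ k → m ≡ p ℕ.* k → Jacobi k) → Jacobi (p ℕ.* m)
  jacobi-*-prime p-prime m jacobi-m jacobi-m/p with prime-mod-4 p-prime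
  ... | inj₁ refl = jacobi-*2 m jacobi-m
  ... | inj₂ (inj₁ (k , p≡1+4k)) = jacobi-*-1mod4 p-prime jacobi-m/p jacobi-m {k} p≡1+4k
  ... | inj₂ (inj₂ (k , p≡3+4k)) = jacobi-*-3mod4 p-prime jacobi-m/p {k} p≡3+4k

  jacobi : ∀ n .{{_ : NonZero n}} → Jacobi n
  jacobi n {{n≢0}} = <-rec (λ n → .(NonZero n) → Jacobi n) step n n≢0
    where
    step : ∀ n → (∀ {j} → j ℕ.< n → .(NonZero j) → Jacobi j) → .(NonZero n) → Jacobi n
    step 1 _ _ = refl
    step n@(suc (suc _)) jacobi-< _ = by-factors (PrimeFactorisation.factors (factorise n)) (PrimeFactorisation.isFactorisation (factorise n)) (PrimeFactorisation.factorsPrime (factorise n))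
      where
      by-factors : ∀ fs → n ≡ product fs → All Prime fs → Jacobi n
      by-factors (p ∷ fs) n≡p*m (p-prime ∷ fs-prime) = subst Jacobi (sym n≡p*m) (jacobi-*-prime p-prime m {{m≢0}} (jacobi-< m<n m≢0) jacobi-m/p)
        where
        m : ℕ
        m = product fs
        m≢0 : NonZero m
        m≢0 = productOfPrimes≢0 fs-prime
        m<n : m ℕ.< n
        m<n = subst (m ℕ.<_) (trans (ℕ.*-comm m p) (sym n≡p*m)) (ℕ.m<m*n m p {{m≢0}} (ℕ.nonTrivial⇒n>1 p {{prime⇒nonTrivial p-prime}}))
        jacobi-m/p : ∀ k → m ≡ p ℕ.* k → Jacobi k
        jacobi-m/p k m≡p*k = jacobi-< (ℕ.≤-<-trans k≤m m<n) k≢0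
          where
          k≢0 : NonZero k
          k≢0 = ℕ.m*n≢0⇒n≢0 p {{subst NonZero m≡p*k m≢0}}
          k≤m : k ℕ.≤ m
          k≤m = subst (k ℕ.≤_) (sym m≡p*k) (ℕ.m≤n*m k p {{prime⇒nonZero p-prime}})

module SquarePartitions where

  open import Defs using (sortedSquareReps; p; r₃; intRange)
  open Counting using (length-unique-⇔; concatMap-unique; length-concatMap)
  open LatticePoints using (ℤ²; norm; pointsOfNorm; r₂; intRange-unique; ∈-intRange; x*x≡∣x∣²; n≤n*n; pointsOfNorm-unique; ∈-pointsOfNorm⁺; ∈-pointsOfNorm⁻)
  open import Data.Nat as ℕ using (ℕ; zero; suc; _+_; _*_; _∸_; z≤n; s≤s; _≤_; _<_; _≤?_; _≟_; _⊓_; _⊔_)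
  import Data.Nat.Properties as ℕ
  open import Data.Nat.Properties using (m≤n⇒m⊓n≡m; m≥n⇒m⊓n≡n; m≤n⇒m⊔n≡n; m≥n⇒m⊔n≡m)
  open import Data.Nat.Tactic.RingSolver using (solve-∀)
  open import Data.Integer as ℤ using (ℤ; +_; -_; ∣_∣)
  import Data.Integer.Properties as ℤ
  open import Data.List using (List; []; _∷_; length; filter; map; concatMap; upTo; _++_; cartesianProduct)
  open import Data.List.Properties using (map-++; map-∘)
  open import Data.List.Membership.Propositional using (_∈_; find; lose)
  open import Data.List.Membership.Propositional.Properties using (∈-filter⁺; ∈-filter⁻; ∈-map⁺; ∈-map⁻; ∈-concatMap⁺; ∈-concatMap⁻; ∈-upTo⁺; ∈-++⁺ˡ; ∈-++⁺ʳ; ∈-++⁻; ∈-cartesianProduct⁺; ∈-cartesianProduct⁻)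
  open import Data.List.Relation.Unary.Any using (here; there)
  import Data.List.Relation.Unary.All as All
  open import Data.List.Relation.Unary.AllPairs using ([]; _∷_)
  open import Data.List.Relation.Unary.Unique.Propositional using (Unique)
  import Data.List.Relation.Unary.Unique.Propositional.Properties as Unique
  open import Data.Product using (_×_; _,_; proj₁; proj₂; ∃; ∃₂)
  open import Data.Sum using (inj₁; inj₂)
  open import Data.Empty using (⊥; ⊥-elim)
  open import Data.Bool using (if_then_else_)
  open import Function.Base using (_∘_)
  open import Function.Bundles using (_⇔_; mk⇔)
  open import Relation.Nullary using (¬_; Dec; yes; no; does)
  open import Relation.Binary.PropositionalEquality using (_≡_; _≢_; refl; sym; trans; cong; cong₂; subst; module ≡-Reasoning)

  IsSortedSquareRep : ℕ → ℕ → ℕ → List ℕ → Set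
  IsSortedSquareRep zero    lo n []      = n ≡ 0
  IsSortedSquareRep zero    lo n (_ ∷ _) = ⊥
  IsSortedSquareRep (suc k) lo n []      = ⊥
  IsSortedSquareRep (suc k) lo n (a ∷ l) = lo ≤ a × a * a ≤ n × IsSortedSquareRep k a (n ∸ a * a) l

  private
    candidates : ℕ → ℕ → List ℕ
    candidates lo n = filter (λ a → lo ≤? a) (filter (λ a → a * a ≤? n) (upTo (suc n)))

    ∈-candidates⁻ : ∀ {lo n a} → a ∈ candidates lo n → lo ≤ a × a * a ≤ n
    ∈-candidates⁻ {lo} {n} a∈ with a∈′ , lo≤a ← ∈-filter⁻ (λ a → lo ≤? a) {xs = filter (λ a → a * a ≤? n) (upTo (suc n))} a∈ =
      lo≤a , proj₂ (∈-filter⁻ (λ a → a * a ≤? n) {xs = upTo (suc n)} a∈′)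

    ∈-candidates⁺ : ∀ {lo n a} → lo ≤ a → a * a ≤ n → a ∈ candidates lo n
    ∈-candidates⁺ {lo} {n} {a} lo≤a a²≤n =
      ∈-filter⁺ (λ a → lo ≤? a) (∈-filter⁺ (λ a → a * a ≤? n) (∈-upTo⁺ (s≤s (ℕ.≤-trans (n≤n*n a) a²≤n))) a²≤n) lo≤a

    [[]]-if : ∀ {P : Set} → Dec P → List (List ℕ)
    [[]]-if P? = if does P? then [] ∷ [] else []

    ∈-[[]]-if⁻ : ∀ {P : Set} (P? : Dec P) {l : List ℕ} → l ∈ [[]]-if P? → P × l ≡ []
    ∈-[[]]-if⁻ (yes p) (here l≡[]) = p , l≡[]
    ∈-[[]]-if⁻ (no _) ()

    ∈-[[]]-if⁺ : ∀ {P : Set} (P? : Dec P) → P → [] ∈ [[]]-if P?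
    ∈-[[]]-if⁺ (yes _) _ = here refl
    ∈-[[]]-if⁺ (no ¬p) p = ⊥-elim (¬p p)

    [[]]-if-unique : ∀ {P : Set} (P? : Dec P) → Unique ([[]]-if P?)
    [[]]-if-unique (yes _) = All.[] ∷ []
    [[]]-if-unique (no _) = []

  ∈-sortedSquareReps⁻ : ∀ k lo n {l} → l ∈ sortedSquareReps k lo n → IsSortedSquareRep k lo n l
  ∈-sortedSquareReps⁻ zero lo n l∈ with n≡0 , refl ← ∈-[[]]-if⁻ (n ≟ 0) l∈ = n≡0
  ∈-sortedSquareReps⁻ (suc k) lo n l∈
    with a , a∈ , l∈a∷ ← find (∈-concatMap⁻ (λ a → map (a ∷_) (sortedSquareReps k a (n ∸ a * a))) {xs = candidates lo n} l∈)
    with l′ , l′∈ , refl ← ∈-map⁻ (a ∷_) l∈a∷ =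
    let lo≤a , a²≤n = ∈-candidates⁻ a∈ in lo≤a , a²≤n , ∈-sortedSquareReps⁻ k a (n ∸ a * a) l′∈

  ∈-sortedSquareReps⁺ : ∀ k lo n {l} → IsSortedSquareRep k lo n l → l ∈ sortedSquareReps k lo n
  ∈-sortedSquareReps⁺ zero lo n {[]} n≡0 = ∈-[[]]-if⁺ (n ≟ 0) n≡0
  ∈-sortedSquareReps⁺ (suc k) lo n {a ∷ l} (lo≤a , a²≤n , rep) =
    ∈-concatMap⁺ (λ a → map (a ∷_) (sortedSquareReps k a (n ∸ a * a)))
      (lose (∈-candidates⁺ lo≤a a²≤n) (∈-map⁺ (a ∷_) (∈-sortedSquareReps⁺ k a (n ∸ a * a) rep)))

  sortedSquareReps-unique : ∀ k lo n → Unique (sortedSquareReps k lo n)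
  sortedSquareReps-unique zero lo n = [[]]-if-unique (n ≟ 0)
  sortedSquareReps-unique (suc k) lo n =
    concatMap-unique (λ a → map (a ∷_) (sortedSquareReps k a (n ∸ a * a))) head
      (Unique.filter⁺ (λ a → lo ≤? a) (Unique.filter⁺ (λ a → a * a ≤? n) (Unique.upTo⁺ (suc n))))
      (λ {a} _ → Unique.map⁺ ∷-injectiveʳ (sortedSquareReps-unique k a (n ∸ a * a)))
      (λ _ l∈ → head-∷ l∈)
    where
    head : List ℕ → ℕ
    head [] = 0
    head (a ∷ _) = a
    ∷-injectiveʳ : ∀ {a} {l l′ : List ℕ} → a ∷ l ≡ a ∷ l′ → l ≡ l′
    ∷-injectiveʳ refl = refl
    head-∷ : ∀ {a ls} {l : List ℕ} → l ∈ map (a ∷_) ls → head l ≡ a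
    head-∷ l∈ with _ , _ , refl ← ∈-map⁻ _ l∈ = refl

  ∈-sortedSquareReps₂⁻ : ∀ {n l} → l ∈ sortedSquareReps 2 0 n → ∃₂ λ a b → l ≡ a ∷ b ∷ [] × a ≤ b × a * a + b * b ≡ n
  ∈-sortedSquareReps₂⁻ {n} {l} l∈ with ∈-sortedSquareReps⁻ 2 0 n l∈
  ∈-sortedSquareReps₂⁻ {n} {a ∷ b ∷ []} l∈ | _ , a²≤n , a≤b , b²≤n-a² , n-a²-b²≡0 =
    a , b , refl , a≤b , trans (cong (_+_ (a * a)) (sym n-a²≡b²)) (ℕ.m+[n∸m]≡n a²≤n)
    where
    n-a²≡b² : n ∸ a * a ≡ b * b
    n-a²≡b² = ℕ.≤-antisym (ℕ.m∸n≡0⇒m≤n n-a²-b²≡0) b²≤n-a²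

  ∈-sortedSquareReps₂⁺ : ∀ {n a b} → a ≤ b → a * a + b * b ≡ n → a ∷ b ∷ [] ∈ sortedSquareReps 2 0 n
  ∈-sortedSquareReps₂⁺ {n} {a} {b} a≤b a²+b²≡n = ∈-sortedSquareReps⁺ 2 0 n
    (z≤n , subst (a * a ≤_) a²+b²≡n (ℕ.m≤m+n (a * a) (b * b)) , a≤b , ℕ.≤-reflexive (sym n-a²≡b²) , trans (cong (_∸ b * b) n-a²≡b²) (ℕ.n∸n≡0 (b * b)))
    where
    n-a²≡b² : n ∸ a * a ≡ b * b
    n-a²≡b² = trans (cong (_∸ a * a) (sym a²+b²≡n)) (ℕ.m+n∸m≡n (a * a) (b * b))

  ∈-sortedSquareReps₃⁻ : ∀ {n l} → l ∈ sortedSquareReps 3 0 n →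
                         ∃₂ λ a b → ∃ λ c → l ≡ a ∷ b ∷ c ∷ [] × a ≤ b × b ≤ c × a * a + b * b + c * c ≡ n
  ∈-sortedSquareReps₃⁻ {n} {l} l∈ with ∈-sortedSquareReps⁻ 3 0 n l∈
  ∈-sortedSquareReps₃⁻ {n} {a ∷ b ∷ c ∷ []} l∈ | _ , a²≤n , a≤b , b²≤n-a² , b≤c , c²≤n-a²-b² , n-a²-b²-c²≡0 =
    a , b , c , refl , a≤b , b≤c , (begin
      a * a + b * b + c * c           ≡⟨ ℕ.+-assoc (a * a) (b * b) (c * c) ⟩
      a * a + (b * b + c * c)         ≡⟨ cong (λ x → a * a + (b * b + x)) (sym n-a²-b²≡c²) ⟩
      a * a + (b * b + (n ∸ a * a ∸ b * b)) ≡⟨ cong (_+_ (a * a)) (ℕ.m+[n∸m]≡n b²≤n-a²) ⟩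
      a * a + (n ∸ a * a)             ≡⟨ ℕ.m+[n∸m]≡n a²≤n ⟩
      n                               ∎)
    where
    open ≡-Reasoning
    n-a²-b²≡c² : n ∸ a * a ∸ b * b ≡ c * c
    n-a²-b²≡c² = ℕ.≤-antisym (ℕ.m∸n≡0⇒m≤n n-a²-b²-c²≡0) c²≤n-a²-b²

  ∈-sortedSquareReps₃⁺ : ∀ {n a b c} → a ≤ b → b ≤ c → a * a + b * b + c * c ≡ n → a ∷ b ∷ c ∷ [] ∈ sortedSquareReps 3 0 n
  ∈-sortedSquareReps₃⁺ {n} {a} {b} {c} a≤b b≤c a²+b²+c²≡n = ∈-sortedSquareReps⁺ 3 0 n
    (z≤n , subst (a * a ≤_) a²+b²+c²≡n (ℕ.≤-trans (ℕ.m≤m+n (a * a) (b * b)) (ℕ.m≤m+n _ (c * c))) ,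
     a≤b , subst (b * b ≤_) (sym n-a²≡b²+c²) (ℕ.m≤m+n (b * b) (c * c)) ,
     b≤c , ℕ.≤-reflexive (sym n-a²-b²≡c²) , trans (cong (_∸ c * c) n-a²-b²≡c²) (ℕ.n∸n≡0 (c * c)))
    where
    n-a²≡b²+c² : n ∸ a * a ≡ b * b + c * c
    n-a²≡b²+c² = trans (cong (_∸ a * a) (trans (sym a²+b²+c²≡n) (ℕ.+-assoc (a * a) (b * b) (c * c)))) (ℕ.m+n∸m≡n (a * a) (b * b + c * c))
    n-a²-b²≡c² : n ∸ a * a ∸ b * b ≡ c * c
    n-a²-b²≡c² = trans (cong (_∸ b * b) n-a²≡b²+c²) (ℕ.m+n∸m≡n (b * b) (c * c))

  signs : ℕ → List ℤ
  signs a = + a ∷ - + a ∷ []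

  ∈-signs⁻ : ∀ {a x} → x ∈ signs a → ∣ x ∣ ≡ a
  ∈-signs⁻ {zero}  (here refl)         = refl
  ∈-signs⁻ {suc a} (here refl)         = refl
  ∈-signs⁻ {zero}  (there (here refl)) = refl
  ∈-signs⁻ {suc a} (there (here refl)) = refl

  ∈-signs-∣∣ : ∀ x → x ∈ signs ∣ x ∣
  ∈-signs-∣∣ (+ k)      = here refl
  ∈-signs-∣∣ ℤ.-[1+ k ] = there (here refl)

  signs-unique : ∀ {a} → 0 < a → Unique (signs a)
  signs-unique {suc a} _ = ((λ ()) All.∷ All.[]) ∷ All.[] ∷ []

  ∈-signs⇒x*x≡ : ∀ {a x} → x ∈ signs a → x ℤ.* x ≡ + (a * a)
  ∈-signs⇒x*x≡ {a} {x} x∈ = trans (x*x≡∣x∣² x) (cong (λ b → + (b * b)) (∈-signs⁻ x∈))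

  norm≡∣x∣²+∣y∣² : ∀ x y → norm (x , y) ≡ + (∣ x ∣ * ∣ x ∣ + ∣ y ∣ * ∣ y ∣)
  norm≡∣x∣²+∣y∣² x y = trans (cong₂ ℤ._+_ (x*x≡∣x∣² x) (x*x≡∣x∣² y)) (sym (ℤ.pos-+ (∣ x ∣ * ∣ x ∣) (∣ y ∣ * ∣ y ∣)))

  StrictReps₂ : ℕ → Set
  StrictReps₂ n = ∀ {a b} → a ≤ b → a * a + b * b ≡ n → 0 < a × a ≢ b

  signedPairs : List ℕ → List ℤ²
  signedPairs (a ∷ b ∷ _) = cartesianProduct (signs a) (signs b) ++ cartesianProduct (signs b) (signs a)
  signedPairs _ = []

  sortedAbs₂ : ℤ² → List ℕ
  sortedAbs₂ (x , y) = ∣ x ∣ ⊓ ∣ y ∣ ∷ ∣ x ∣ ⊔ ∣ y ∣ ∷ []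

  signedPairs-unique : ∀ {a b} → 0 < a → a ≤ b → a ≢ b → Unique (signedPairs (a ∷ b ∷ []))
  signedPairs-unique {a} {b} 0<a a≤b a≢b =
    Unique.++⁺ (Unique.cartesianProduct⁺ (signs-unique 0<a) (signs-unique 0<b)) (Unique.cartesianProduct⁺ (signs-unique 0<b) (signs-unique 0<a)) disjoint
    where
    0<b : 0 < b
    0<b = ℕ.<-≤-trans 0<a a≤b
    disjoint : ∀ {z} → ¬ (z ∈ cartesianProduct (signs a) (signs b) × z ∈ cartesianProduct (signs b) (signs a))
    disjoint {x , y} (z∈ab , z∈ba) =
      a≢b (trans (sym (∈-signs⁻ (proj₁ (∈-cartesianProduct⁻ (signs a) (signs b) z∈ab)))) (∈-signs⁻ (proj₁ (∈-cartesianProduct⁻ (signs b) (signs a) z∈ba))))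

  sortedAbs₂-signedPairs : ∀ {a b z} → a ≤ b → z ∈ signedPairs (a ∷ b ∷ []) → sortedAbs₂ z ≡ a ∷ b ∷ []
  sortedAbs₂-signedPairs {a} {b} {x , y} a≤b z∈ with ∈-++⁻ (cartesianProduct (signs a) (signs b)) z∈
  ... | inj₁ z∈ab with x∈ , y∈ ← ∈-cartesianProduct⁻ (signs a) (signs b) z∈ab rewrite ∈-signs⁻ x∈ | ∈-signs⁻ y∈ =
    cong₂ (λ u v → u ∷ v ∷ []) (m≤n⇒m⊓n≡m a≤b) (m≤n⇒m⊔n≡n a≤b)
  ... | inj₂ z∈ba with x∈ , y∈ ← ∈-cartesianProduct⁻ (signs b) (signs a) z∈ba rewrite ∈-signs⁻ x∈ | ∈-signs⁻ y∈ =
    cong₂ (λ u v → u ∷ v ∷ []) (m≥n⇒m⊓n≡n a≤b) (m≥n⇒m⊔n≡m a≤b)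

  norm-signedPairs : ∀ {a b z} → z ∈ signedPairs (a ∷ b ∷ []) → norm z ≡ + (a * a + b * b)
  norm-signedPairs {a} {b} {x , y} z∈ with ∈-++⁻ (cartesianProduct (signs a) (signs b)) z∈
  ... | inj₁ z∈ab with x∈ , y∈ ← ∈-cartesianProduct⁻ (signs a) (signs b) z∈ab =
    trans (cong₂ ℤ._+_ (∈-signs⇒x*x≡ x∈) (∈-signs⇒x*x≡ y∈)) (sym (ℤ.pos-+ (a * a) (b * b)))
  ... | inj₂ z∈ba with x∈ , y∈ ← ∈-cartesianProduct⁻ (signs b) (signs a) z∈ba =
    trans (cong₂ ℤ._+_ (∈-signs⇒x*x≡ x∈) (∈-signs⇒x*x≡ y∈)) (trans (sym (ℤ.pos-+ (b * b) (a * a))) (cong +_ (ℕ.+-comm (b * b) (a * a))))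

  ∈-signedPairs : ∀ x y → ∃₂ λ a b → a ≤ b × (x , y) ∈ signedPairs (a ∷ b ∷ []) × a * a + b * b ≡ ∣ x ∣ * ∣ x ∣ + ∣ y ∣ * ∣ y ∣
  ∈-signedPairs x y with ℕ.≤-total ∣ x ∣ ∣ y ∣
  ... | inj₁ ∣x∣≤∣y∣ = ∣ x ∣ , ∣ y ∣ , ∣x∣≤∣y∣ , ∈-++⁺ˡ (∈-cartesianProduct⁺ (∈-signs-∣∣ x) (∈-signs-∣∣ y)) , refl
  ... | inj₂ ∣y∣≤∣x∣ = ∣ y ∣ , ∣ x ∣ , ∣y∣≤∣x∣ , ∈-++⁺ʳ (cartesianProduct (signs ∣ y ∣) (signs ∣ x ∣)) (∈-cartesianProduct⁺ (∈-signs-∣∣ x) (∈-signs-∣∣ y)) ,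
                       ℕ.+-comm (∣ y ∣ * ∣ y ∣) _

  -- Each sorted representation a < b with a > 0 accounts for the 8 points (± a , ± b), (± b , ± a).
  r₂≡8*p₂ : ∀ {n} → StrictReps₂ n → r₂ n ≡ 8 * p 2 n
  r₂≡8*p₂ {n} strict = begin
    length (pointsOfNorm n)                                  ≡⟨ length-unique-⇔ (pointsOfNorm-unique n) blocks-unique (mk⇔ to from) ⟩
    length (concatMap signedPairs (sortedSquareReps 2 0 n))  ≡⟨ length-concatMap 8 signedPairs (sortedSquareReps 2 0 n) block-length ⟩
    8 * p 2 n                                                ∎
    where
    open ≡-Reasoning
    block-length : ∀ {l} → l ∈ sortedSquareReps 2 0 n → length (signedPairs l) ≡ 8
    block-length l∈ with _ , _ , refl , _ ← ∈-sortedSquareReps₂⁻ {n} l∈ = refl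
    block-unique : ∀ {l} → l ∈ sortedSquareReps 2 0 n → Unique (signedPairs l)
    block-unique l∈ with a , b , refl , a≤b , a²+b²≡n ← ∈-sortedSquareReps₂⁻ {n} l∈ =
      let 0<a , a≢b = strict a≤b a²+b²≡n in signedPairs-unique 0<a a≤b a≢b
    labelled : ∀ {l z} → l ∈ sortedSquareReps 2 0 n → z ∈ signedPairs l → sortedAbs₂ z ≡ l
    labelled l∈ z∈ with a , b , refl , a≤b , _ ← ∈-sortedSquareReps₂⁻ {n} l∈ = sortedAbs₂-signedPairs a≤b z∈
    blocks-unique : Unique (concatMap signedPairs (sortedSquareReps 2 0 n))
    blocks-unique = concatMap-unique signedPairs sortedAbs₂ (sortedSquareReps-unique 2 0 n) block-unique labelled
    to : ∀ {z} → z ∈ pointsOfNorm n → z ∈ concatMap signedPairs (sortedSquareReps 2 0 n)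
    to {x , y} z∈ with a , b , a≤b , z∈ab , a²+b²≡ ← ∈-signedPairs x y =
      ∈-concatMap⁺ signedPairs (lose (∈-sortedSquareReps₂⁺ {n} a≤b (trans a²+b²≡ ∣x∣²+∣y∣²≡n)) z∈ab)
      where
      ∣x∣²+∣y∣²≡n : ∣ x ∣ * ∣ x ∣ + ∣ y ∣ * ∣ y ∣ ≡ n
      ∣x∣²+∣y∣²≡n = ℤ.+-injective (trans (sym (norm≡∣x∣²+∣y∣² x y)) (∈-pointsOfNorm⁻ z∈))
    from : ∀ {z} → z ∈ concatMap signedPairs (sortedSquareReps 2 0 n) → z ∈ pointsOfNorm n
    from z∈ with l , l∈ , z∈l ← find (∈-concatMap⁻ signedPairs {xs = sortedSquareReps 2 0 n} z∈)
      with a , b , refl , _ , a²+b²≡n ← ∈-sortedSquareReps₂⁻ {n} l∈ = ∈-pointsOfNorm⁺ (trans (norm-signedPairs z∈l) (cong +_ a²+b²≡n))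

  ℤ³ : Set
  ℤ³ = ℤ × ℤ × ℤ

  norm₃ : ℤ³ → ℤ
  norm₃ (x , y , z) = x ℤ.* x ℤ.+ y ℤ.* y ℤ.+ z ℤ.* z

  cube : ℕ → List ℤ³
  cube n = cartesianProduct (intRange n) (cartesianProduct (intRange n) (intRange n))

  pointsOfNorm₃ : ℕ → List ℤ³
  pointsOfNorm₃ n = filter (λ t → norm₃ t ℤ.≟ + n) (cube n)

  private
    nested≡cartesianProduct : ∀ (xs ys zs : List ℤ) →
      concatMap (λ x → concatMap (λ y → map (λ z → x , y , z) zs) ys) xs ≡ cartesianProduct xs (cartesianProduct ys zs)
    nested≡cartesianProduct [] ys zs = refl
    nested≡cartesianProduct (x ∷ xs) ys zs = cong₂ _++_ (inner ys) (nested≡cartesianProduct xs ys zs)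
      where
      inner : ∀ ys → concatMap (λ y → map (λ z → x , y , z) zs) ys ≡ map (x ,_) (cartesianProduct ys zs)
      inner [] = refl
      inner (y ∷ ys) = trans (cong₂ _++_ (map-∘ zs) (inner ys)) (sym (map-++ (x ,_) (map (y ,_) zs) (cartesianProduct ys zs)))

  r₃≡length-pointsOfNorm₃ : ∀ n → r₃ n ≡ length (pointsOfNorm₃ n)
  r₃≡length-pointsOfNorm₃ n = cong (λ ts → length (filter (λ t → norm₃ t ℤ.≟ + n) ts)) (nested≡cartesianProduct (intRange n) (intRange n) (intRange n))

  pointsOfNorm₃-unique : ∀ n → Unique (pointsOfNorm₃ n)
  pointsOfNorm₃-unique n = Unique.filter⁺ (λ t → norm₃ t ℤ.≟ + n) (Unique.cartesianProduct⁺ (intRange-unique n) (Unique.cartesianProduct⁺ (intRange-unique n) (intRange-unique n)))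

  abs₃ : ℤ³ → ℕ × ℕ × ℕ
  abs₃ (x , y , z) = ∣ x ∣ , ∣ y ∣ , ∣ z ∣

  sumOfSquares₃ : ℕ × ℕ × ℕ → ℕ
  sumOfSquares₃ (u , v , w) = u * u + v * v + w * w

  norm₃≡sumOfSquares₃ : ∀ t → norm₃ t ≡ + sumOfSquares₃ (abs₃ t)
  norm₃≡sumOfSquares₃ (x , y , z) = trans (cong₂ ℤ._+_ (cong₂ ℤ._+_ (x*x≡∣x∣² x) (x*x≡∣x∣² y)) (x*x≡∣x∣² z))
    (trans (cong (ℤ._+ + (∣ z ∣ * ∣ z ∣)) (sym (ℤ.pos-+ (∣ x ∣ * ∣ x ∣) (∣ y ∣ * ∣ y ∣)))) (sym (ℤ.pos-+ (∣ x ∣ * ∣ x ∣ + ∣ y ∣ * ∣ y ∣) (∣ z ∣ * ∣ z ∣))))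

  ∈-pointsOfNorm₃⁺ : ∀ {n} t → norm₃ t ≡ + n → t ∈ pointsOfNorm₃ n
  ∈-pointsOfNorm₃⁺ {n} t@(x , y , z) eq = ∈-filter⁺ (λ t → norm₃ t ℤ.≟ + n)
    (∈-cartesianProduct⁺ (∈-intRange x (bound ∣ x ∣ (ℕ.≤-trans (ℕ.m≤m+n _ (∣ y ∣ * ∣ y ∣)) (ℕ.m≤m+n _ (∣ z ∣ * ∣ z ∣)))))
      (∈-cartesianProduct⁺ (∈-intRange y (bound ∣ y ∣ (ℕ.≤-trans (ℕ.m≤n+m _ (∣ x ∣ * ∣ x ∣)) (ℕ.m≤m+n _ (∣ z ∣ * ∣ z ∣)))))
                           (∈-intRange z (bound ∣ z ∣ (ℕ.m≤n+m _ (∣ x ∣ * ∣ x ∣ + ∣ y ∣ * ∣ y ∣)))))) eq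
    where
    sum≡n : sumOfSquares₃ (abs₃ t) ≡ n
    sum≡n = ℤ.+-injective (trans (sym (norm₃≡sumOfSquares₃ t)) eq)
    bound : ∀ a → a * a ≤ sumOfSquares₃ (abs₃ t) → a ≤ n
    bound a a²≤ = ℕ.≤-trans (n≤n*n a) (subst (a * a ≤_) sum≡n a²≤)

  ∈-pointsOfNorm₃⁻ : ∀ {n t} → t ∈ pointsOfNorm₃ n → norm₃ t ≡ + n
  ∈-pointsOfNorm₃⁻ {n} t∈ = proj₂ (∈-filter⁻ (λ t → norm₃ t ℤ.≟ + n) {xs = cube n} t∈)

  permutations₃ : ℕ → ℕ → ℕ → List (ℕ × ℕ × ℕ)
  permutations₃ a b c = (a , b , c) ∷ (a , c , b) ∷ (b , a , c) ∷ (b , c , a) ∷ (c , a , b) ∷ (c , b , a) ∷ []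

  permutations₃-unique : ∀ {a b c} → a ≢ b → b ≢ c → a ≢ c → Unique (permutations₃ a b c)
  permutations₃-unique a≢b b≢c a≢c =
    (second b≢c All.∷ first a≢b All.∷ first a≢b All.∷ first a≢c All.∷ first a≢c All.∷ All.[]) ∷
    (first a≢b All.∷ first a≢b All.∷ first a≢c All.∷ first a≢c All.∷ All.[]) ∷
    (second a≢c All.∷ first b≢c All.∷ first b≢c All.∷ All.[]) ∷
    (first b≢c All.∷ first b≢c All.∷ All.[]) ∷
    (second a≢b All.∷ All.[]) ∷
    All.[] ∷ []
    where
    first : ∀ {x y : ℕ} {s t : ℕ × ℕ} → x ≢ y → (x , s) ≢ (y , t)
    first x≢y eq = x≢y (cong proj₁ eq)
    second : ∀ {u x y z w : ℕ} → x ≢ y → (u , x , z) ≢ (u , y , w)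
    second x≢y eq = x≢y (cong (proj₁ ∘ proj₂) eq)

  sumOfSquares₃-permutation : ∀ {a b c t} → t ∈ permutations₃ a b c → sumOfSquares₃ t ≡ sumOfSquares₃ (a , b , c)
  sumOfSquares₃-permutation {a} {b} {c} (here refl) = refl
  sumOfSquares₃-permutation {a} {b} {c} (there (here refl)) = identity a b c
    where
    identity : ∀ a b c → a * a + c * c + b * b ≡ a * a + b * b + c * c
    identity = solve-∀
  sumOfSquares₃-permutation {a} {b} {c} (there (there (here refl))) = identity a b c
    where
    identity : ∀ a b c → b * b + a * a + c * c ≡ a * a + b * b + c * c
    identity = solve-∀
  sumOfSquares₃-permutation {a} {b} {c} (there (there (there (here refl)))) = identity a b c
    where
    identity : ∀ a b c → b * b + c * c + a * a ≡ a * a + b * b + c * c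
    identity = solve-∀
  sumOfSquares₃-permutation {a} {b} {c} (there (there (there (there (here refl))))) = identity a b c
    where
    identity : ∀ a b c → c * c + a * a + b * b ≡ a * a + b * b + c * c
    identity = solve-∀
  sumOfSquares₃-permutation {a} {b} {c} (there (there (there (there (there (here refl)))))) = identity a b c
    where
    identity : ∀ a b c → c * c + b * b + a * a ≡ a * a + b * b + c * c
    identity = solve-∀

  sort-triple : ∀ u v w → ∃₂ λ a b → ∃ λ c → a ≤ b × b ≤ c × (u , v , w) ∈ permutations₃ a b c
  sort-triple u v w with ℕ.≤-total u v | ℕ.≤-total v w | ℕ.≤-total u w
  ... | inj₁ u≤v | inj₁ v≤w | _        = u , v , w , u≤v , v≤w , here refl
  ... | inj₁ u≤v | inj₂ w≤v | inj₁ u≤w = u , w , v , u≤w , w≤v , there (here refl)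
  ... | inj₁ u≤v | inj₂ w≤v | inj₂ w≤u = w , u , v , w≤u , u≤v , there (there (there (here refl)))
  ... | inj₂ v≤u | _        | inj₁ u≤w = v , u , w , v≤u , u≤w , there (there (here refl))
  ... | inj₂ v≤u | inj₁ v≤w | inj₂ w≤u = v , w , u , v≤w , w≤u , there (there (there (there (here refl))))
  ... | inj₂ v≤u | inj₂ w≤v | inj₂ w≤u = w , v , u , w≤v , v≤u , there (there (there (there (there (here refl)))))

  -- The middle entry is recovered as the sum minus the two extremes.
  sort₃ : ℕ × ℕ × ℕ → List ℕ
  sort₃ (u , v , w) = u ⊓ v ⊓ w ∷ (u + v + w) ∸ ((u ⊓ v ⊓ w) + (u ⊔ v ⊔ w)) ∷ u ⊔ v ⊔ w ∷ []

  private
    extremes : ∀ {a b c} → a ≤ b → b ≤ c → a ≤ c → ∀ {u v w} → (u , v , w) ∈ permutations₃ a b c →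
               u ⊓ v ⊓ w ≡ a × u ⊔ v ⊔ w ≡ c × u + v + w ≡ a + b + c
    extremes {a} {b} {c} a≤b b≤c a≤c (here refl) =
      trans (cong (_⊓ c) (m≤n⇒m⊓n≡m a≤b)) (m≤n⇒m⊓n≡m a≤c) , trans (cong (_⊔ c) (m≤n⇒m⊔n≡n a≤b)) (m≤n⇒m⊔n≡n b≤c) , refl
    extremes {a} {b} {c} a≤b b≤c a≤c (there (here refl)) =
      trans (cong (_⊓ b) (m≤n⇒m⊓n≡m a≤c)) (m≤n⇒m⊓n≡m a≤b) , trans (cong (_⊔ b) (m≤n⇒m⊔n≡n a≤c)) (m≥n⇒m⊔n≡m b≤c) , identity a b c
      where
      identity : ∀ a b c → a + c + b ≡ a + b + c
      identity = solve-∀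
    extremes {a} {b} {c} a≤b b≤c a≤c (there (there (here refl))) =
      trans (cong (_⊓ c) (m≥n⇒m⊓n≡n a≤b)) (m≤n⇒m⊓n≡m a≤c) , trans (cong (_⊔ c) (m≥n⇒m⊔n≡m a≤b)) (m≤n⇒m⊔n≡n b≤c) , identity a b c
      where
      identity : ∀ a b c → b + a + c ≡ a + b + c
      identity = solve-∀
    extremes {a} {b} {c} a≤b b≤c a≤c (there (there (there (here refl)))) =
      trans (cong (_⊓ a) (m≤n⇒m⊓n≡m b≤c)) (m≥n⇒m⊓n≡n a≤b) , trans (cong (_⊔ a) (m≤n⇒m⊔n≡n b≤c)) (m≥n⇒m⊔n≡m a≤c) , identity a b c
      where
      identity : ∀ a b c → b + c + a ≡ a + b + c
      identity = solve-∀
    extremes {a} {b} {c} a≤b b≤c a≤c (there (there (there (there (here refl))))) =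
      trans (cong (_⊓ b) (m≥n⇒m⊓n≡n a≤c)) (m≤n⇒m⊓n≡m a≤b) , trans (cong (_⊔ b) (m≥n⇒m⊔n≡m a≤c)) (m≥n⇒m⊔n≡m b≤c) , identity a b c
      where
      identity : ∀ a b c → c + a + b ≡ a + b + c
      identity = solve-∀
    extremes {a} {b} {c} a≤b b≤c a≤c (there (there (there (there (there (here refl)))))) =
      trans (cong (_⊓ a) (m≥n⇒m⊓n≡n b≤c)) (m≥n⇒m⊓n≡n a≤b) , trans (cong (_⊔ a) (m≥n⇒m⊔n≡m b≤c)) (m≥n⇒m⊔n≡m a≤c) , identity a b c
      where
      identity : ∀ a b c → c + b + a ≡ a + b + c
      identity = solve-∀

  sort₃-permutation : ∀ {a b c t} → a ≤ b → b ≤ c → t ∈ permutations₃ a b c → sort₃ t ≡ a ∷ b ∷ c ∷ []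
  sort₃-permutation {a} {b} {c} {u , v , w} a≤b b≤c t∈ with min≡a , max≡c , sum≡ ← extremes a≤b b≤c (ℕ.≤-trans a≤b b≤c) t∈ =
    cong₂ _∷_ min≡a (cong₂ _∷_ (trans (cong₂ _∸_ sum≡ (cong₂ _+_ min≡a max≡c)) middle) (cong₂ _∷_ max≡c refl))
    where
    middle : (a + b + c) ∸ (a + c) ≡ b
    middle = trans (cong (_∸ (a + c)) (identity a b c)) (ℕ.m+n∸m≡n (a + c) b)
      where
      identity : ∀ a b c → a + b + c ≡ a + c + b
      identity = solve-∀

  StrictReps₃ : ℕ → Set
  StrictReps₃ n = ∀ {a b c} → a ≤ b → b ≤ c → a * a + b * b + c * c ≡ n → 0 < a × a ≢ b × b ≢ c

  signedTriplesOf : ℕ × ℕ × ℕ → List ℤ³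
  signedTriplesOf (u , v , w) = cartesianProduct (signs u) (cartesianProduct (signs v) (signs w))

  ∈-signedTriplesOf⁻ : ∀ {s t} → t ∈ signedTriplesOf s → abs₃ t ≡ s
  ∈-signedTriplesOf⁻ {u , v , w} {x , y , z} t∈
    with x∈ , yz∈ ← ∈-cartesianProduct⁻ (signs u) (cartesianProduct (signs v) (signs w)) t∈
    with y∈ , z∈ ← ∈-cartesianProduct⁻ (signs v) (signs w) yz∈ =
    cong₂ _,_ (∈-signs⁻ x∈) (cong₂ _,_ (∈-signs⁻ y∈) (∈-signs⁻ z∈))

  ∈-signedTriplesOf-abs₃ : ∀ t → t ∈ signedTriplesOf (abs₃ t)
  ∈-signedTriplesOf-abs₃ (x , y , z) = ∈-cartesianProduct⁺ (∈-signs-∣∣ x) (∈-cartesianProduct⁺ (∈-signs-∣∣ y) (∈-signs-∣∣ z))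

  signedTriplesOf-unique : ∀ {u v w} → 0 < u ⊓ v ⊓ w → Unique (signedTriplesOf (u , v , w))
  signedTriplesOf-unique {u} {v} {w} 0<min = Unique.cartesianProduct⁺ (signs-unique 0<u) (Unique.cartesianProduct⁺ (signs-unique 0<v) (signs-unique 0<w))
    where
    0<u⊓v : 0 < u ⊓ v
    0<u⊓v = ℕ.<-≤-trans 0<min (ℕ.m⊓n≤m (u ⊓ v) w)
    0<u : 0 < u
    0<u = ℕ.<-≤-trans 0<u⊓v (ℕ.m⊓n≤m u v)
    0<v : 0 < v
    0<v = ℕ.<-≤-trans 0<u⊓v (ℕ.m⊓n≤n u v)
    0<w : 0 < w
    0<w = ℕ.<-≤-trans 0<min (ℕ.m⊓n≤n (u ⊓ v) w)

  signedTriples : List ℕ → List ℤ³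
  signedTriples (a ∷ b ∷ c ∷ _) = concatMap signedTriplesOf (permutations₃ a b c)
  signedTriples _ = []

  signedTriples-unique : ∀ {a b c} → 0 < a → a ≤ b → b ≤ c → a ≢ b → b ≢ c → Unique (signedTriples (a ∷ b ∷ c ∷ []))
  signedTriples-unique {a} {b} {c} 0<a a≤b b≤c a≢b b≢c =
    concatMap-unique signedTriplesOf abs₃ (permutations₃-unique a≢b b≢c a≢c)
      (λ t∈ → signedTriplesOf-unique (subst (0 <_) (sym (proj₁ (extremes a≤b b≤c a≤c t∈))) 0<a))
      (λ _ t∈ → ∈-signedTriplesOf⁻ t∈)
    where
    a≤c : a ≤ c
    a≤c = ℕ.≤-trans a≤b b≤c
    a≢c : a ≢ c
    a≢c a≡c = a≢b (ℕ.≤-antisym a≤b (subst (b ≤_) (sym a≡c) b≤c))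

  sort₃-signedTriples : ∀ {a b c t} → a ≤ b → b ≤ c → t ∈ signedTriples (a ∷ b ∷ c ∷ []) → sort₃ (abs₃ t) ≡ a ∷ b ∷ c ∷ []
  sort₃-signedTriples {a} {b} {c} a≤b b≤c t∈ with s , s∈ , t∈s ← find (∈-concatMap⁻ signedTriplesOf {xs = permutations₃ a b c} t∈) =
    trans (cong sort₃ (∈-signedTriplesOf⁻ t∈s)) (sort₃-permutation a≤b b≤c s∈)

  norm₃-signedTriples : ∀ {a b c t} → t ∈ signedTriples (a ∷ b ∷ c ∷ []) → norm₃ t ≡ + sumOfSquares₃ (a , b , c)
  norm₃-signedTriples {a} {b} {c} {t} t∈ with s , s∈ , t∈s ← find (∈-concatMap⁻ signedTriplesOf {xs = permutations₃ a b c} t∈) =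
    trans (norm₃≡sumOfSquares₃ t) (cong +_ (trans (cong sumOfSquares₃ (∈-signedTriplesOf⁻ t∈s)) (sumOfSquares₃-permutation s∈)))

  ∈-signedTriples : ∀ t → ∃₂ λ a b → ∃ λ c → a ≤ b × b ≤ c × t ∈ signedTriples (a ∷ b ∷ c ∷ []) × sumOfSquares₃ (a , b , c) ≡ sumOfSquares₃ (abs₃ t)
  ∈-signedTriples t@(x , y , z) with a , b , c , a≤b , b≤c , abs∈ ← sort-triple (∣ x ∣) (∣ y ∣) (∣ z ∣) =
    a , b , c , a≤b , b≤c , ∈-concatMap⁺ signedTriplesOf (lose abs∈ (∈-signedTriplesOf-abs₃ t)) , sym (sumOfSquares₃-permutation abs∈)

  -- Each sorted representation 0 < a < b < c accounts for the 48 points obtained by permuting and changing signs.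
  r₃≡48*p₃ : ∀ {n} → StrictReps₃ n → r₃ n ≡ 48 * p 3 n
  r₃≡48*p₃ {n} strict = begin
    r₃ n                                                       ≡⟨ r₃≡length-pointsOfNorm₃ n ⟩
    length (pointsOfNorm₃ n)                                   ≡⟨ length-unique-⇔ (pointsOfNorm₃-unique n) blocks-unique (mk⇔ to from) ⟩
    length (concatMap signedTriples (sortedSquareReps 3 0 n))  ≡⟨ length-concatMap 48 signedTriples (sortedSquareReps 3 0 n) block-length ⟩
    48 * p 3 n                                                 ∎
    where
    open ≡-Reasoning
    block-length : ∀ {l} → l ∈ sortedSquareReps 3 0 n → length (signedTriples l) ≡ 48
    block-length l∈ with _ , _ , _ , refl , _ ← ∈-sortedSquareReps₃⁻ {n} l∈ = refl
    block-unique : ∀ {l} → l ∈ sortedSquareReps 3 0 n → Unique (signedTriples l)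
    block-unique l∈ with a , b , c , refl , a≤b , b≤c , sum≡n ← ∈-sortedSquareReps₃⁻ {n} l∈ =
      let 0<a , a≢b , b≢c = strict a≤b b≤c sum≡n in signedTriples-unique 0<a a≤b b≤c a≢b b≢c
    labelled : ∀ {l t} → l ∈ sortedSquareReps 3 0 n → t ∈ signedTriples l → sort₃ (abs₃ t) ≡ l
    labelled l∈ t∈ with a , b , c , refl , a≤b , b≤c , _ ← ∈-sortedSquareReps₃⁻ {n} l∈ = sort₃-signedTriples a≤b b≤c t∈
    blocks-unique : Unique (concatMap signedTriples (sortedSquareReps 3 0 n))
    blocks-unique = concatMap-unique signedTriples (sort₃ ∘ abs₃) (sortedSquareReps-unique 3 0 n) block-unique labelled
    to : ∀ {t} → t ∈ pointsOfNorm₃ n → t ∈ concatMap signedTriples (sortedSquareReps 3 0 n)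
    to {t} t∈ with a , b , c , a≤b , b≤c , t∈abc , sum≡ ← ∈-signedTriples t =
      ∈-concatMap⁺ signedTriples (lose (∈-sortedSquareReps₃⁺ {n} a≤b b≤c (trans sum≡ (ℤ.+-injective (trans (sym (norm₃≡sumOfSquares₃ t)) (∈-pointsOfNorm₃⁻ t∈))))) t∈abc)
    from : ∀ {t} → t ∈ concatMap signedTriples (sortedSquareReps 3 0 n) → t ∈ pointsOfNorm₃ n
    from {t} t∈ with l , l∈ , t∈l ← find (∈-concatMap⁻ signedTriples {xs = sortedSquareReps 3 0 n} t∈)
      with a , b , c , refl , _ , _ , sum≡n ← ∈-sortedSquareReps₃⁻ {n} l∈ = ∈-pointsOfNorm₃⁺ t (trans (norm₃-signedTriples t∈l) (cong +_ sum≡n))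

module Residues where

  open FiniteChecks using (∀<²-by-decision)
  open SquarePartitions using (StrictReps₂; StrictReps₃)
  import Data.Nat.Properties as ℕ
  open import Data.Nat using (ℕ; zero; suc; NonZero; _+_; _*_; _%_; _<_; _≟_; s≤s; z≤n)
  open import Data.Nat.DivMod using (%-distribˡ-+; %-distribˡ-*; m%n%n≡m%n; m%n<n)
  open import Data.Nat.Tactic.RingSolver using (solve-∀)
  open import Data.List using (upTo)
  open import Data.List.Relation.Unary.All using (all?)
  open import Data.Product using (_,_)
  open import Data.Empty using (⊥-elim)
  open import Relation.Nullary using (¬?)
  open import Relation.Nullary.Decidable using (True)
  open import Relation.Binary.PropositionalEquality using (_≡_; _≢_; refl; sym; trans; cong; cong₂; module ≡-Reasoning)

  module _ {m : ℕ} .{{_ : NonZero m}} where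

    %-+-cong : ∀ {a b c d} → a % m ≡ b % m → c % m ≡ d % m → (a + c) % m ≡ (b + d) % m
    %-+-cong {a} {b} {c} {d} a≡b c≡d = begin
      (a + c) % m               ≡⟨ %-distribˡ-+ a c m ⟩
      (a % m + c % m) % m       ≡⟨ cong₂ (λ x y → (x + y) % m) a≡b c≡d ⟩
      (b % m + d % m) % m       ≡⟨ sym (%-distribˡ-+ b d m) ⟩
      (b + d) % m               ∎
      where open ≡-Reasoning

    %-*-cong : ∀ {a b c d} → a % m ≡ b % m → c % m ≡ d % m → (a * c) % m ≡ (b * d) % m
    %-*-cong {a} {b} {c} {d} a≡b c≡d = begin
      (a * c) % m               ≡⟨ %-distribˡ-* a c m ⟩
      (a % m * (c % m)) % m     ≡⟨ cong₂ (λ x y → (x * y) % m) a≡b c≡d ⟩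
      (b % m * (d % m)) % m     ≡⟨ sym (%-distribˡ-* b d m) ⟩
      (b * d) % m               ∎
      where open ≡-Reasoning

    quadraticForm-% : ∀ u v x y → (u * (x * x) + v * (y * y)) % m ≡ (u * (x % m * (x % m)) + v * (y % m * (y % m))) % m
    quadraticForm-% u v x y = %-+-cong (%-*-cong {u} refl (%-*-cong x≡x%m x≡x%m)) (%-*-cong {v} refl (%-*-cong y≡y%m y≡y%m))
      where
      x≡x%m : x % m ≡ (x % m) % m
      x≡x%m = sym (m%n%n≡m%n x m)
      y≡y%m : y % m ≡ (y % m) % m
      y≡y%m = sym (m%n%n≡m%n y m)

  QuadraticFormAvoids : (m u v r : ℕ) .{{_ : NonZero m}} → Set
  QuadraticFormAvoids m u v r = ∀ x y → (u * (x * x) + v * (y * y)) % m ≢ r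

  quadraticFormAvoids-by-decision : ∀ m u v r .{{_ : NonZero m}} →
    True (all? (λ i → all? (λ j → ¬? ((u * (i * i) + v * (j * j)) % m ≟ r)) (upTo m)) (upTo m)) →
    QuadraticFormAvoids m u v r
  quadraticFormAvoids-by-decision m u v r checked x y form≡r =
    ∀<²-by-decision (λ i j → ¬? ((u * (i * i) + v * (j * j)) % m ≟ r)) m checked (m%n<n x m) (m%n<n y m)
      (trans (sym (quadraticForm-% u v x y)) form≡r)

  module _ (m : ℕ) .{{_ : NonZero m}} {n r : ℕ} (n%m≡r : n % m ≡ r) where

    private
      avoids : ∀ u v x y → QuadraticFormAvoids m u v r → u * (x * x) + v * (y * y) ≢ n
      avoids u v x y avoid form≡n = avoid x y (trans (cong (_% m) form≡n) n%m≡r)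

    strictReps₂-by-residue : QuadraticFormAvoids m 0 1 r → QuadraticFormAvoids m 2 0 r → StrictReps₂ n
    strictReps₂-by-residue avoid-0,1 avoid-2,0 {a} {b} _ a²+b²≡n = positive a a²+b²≡n , distinct
      where
      positive : ∀ a → a * a + b * b ≡ n → 0 < a
      positive zero b²≡n = ⊥-elim (avoids 0 1 0 b avoid-0,1 (trans (ℕ.+-identityʳ (b * b)) b²≡n))
      positive (suc _) _ = s≤s z≤n
      distinct : a ≢ b
      distinct refl = avoids 2 0 a 0 avoid-2,0 (trans (identity a) a²+b²≡n)
        where
        identity : ∀ a → 2 * (a * a) + 0 * (0 * 0) ≡ a * a + a * a
        identity = solve-∀

    strictReps₃-by-residue : QuadraticFormAvoids m 1 1 r → QuadraticFormAvoids m 2 1 r → StrictReps₃ n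
    strictReps₃-by-residue avoid-1,1 avoid-2,1 {a} {b} {c} _ _ sum≡n = positive a sum≡n , a≢b , b≢c
      where
      positive : ∀ a → a * a + b * b + c * c ≡ n → 0 < a
      positive zero b²+c²≡n = ⊥-elim (avoids 1 1 b c avoid-1,1 (trans (identity b c) b²+c²≡n))
        where
        identity : ∀ b c → 1 * (b * b) + 1 * (c * c) ≡ 0 * 0 + b * b + c * c
        identity = solve-∀
      positive (suc _) _ = s≤s z≤n
      a≢b : a ≢ b
      a≢b refl = avoids 2 1 a c avoid-2,1 (trans (identity a c) sum≡n)
        where
        identity : ∀ a c → 2 * (a * a) + 1 * (c * c) ≡ a * a + a * a + c * c
        identity = solve-∀
      b≢c : b ≢ c
      b≢c refl = avoids 2 1 b a avoid-2,1 (trans (identity a b) sum≡n)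
        where
        identity : ∀ a b → 2 * (b * b) + 1 * (a * a) ≡ a * a + b * b + b * b
        identity = solve-∀

open import Defs
open import Data.Nat using (ℕ; _+_; _*_)
open import Data.Integer using (+_)
open import Data.Product using (_×_; ∃; _,_)
open import Relation.Binary.PropositionalEquality using (_≡_; refl; sym; trans; cong; module ≡-Reasoning)

open LatticePoints using (r₂)
open SquarePartitions using (StrictReps₂; r₂≡8*p₂; r₃≡48*p₃)
open TwoSquaresTheorem using (jacobi)
open Residues using (quadraticFormAvoids-by-decision; strictReps₂-by-residue; strictReps₃-by-residue)
import Data.Nat as ℕ
import Data.Nat.Properties as ℕ
open import Data.Nat.DivMod using ([m+kn]%n≡m%n)
open import Data.Nat.Tactic.RingSolver using (solve-∀)
import Data.Integer as ℤ
import Data.Integer.Properties as ℤ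

2*p₂≡divisorSumχ₄ : ∀ n .{{_ : ℕ.NonZero n}} → StrictReps₂ n → + 2 ℤ.* + p 2 n ≡ divisorSumχ₄ n
2*p₂≡divisorSumχ₄ n strict = ℤ.*-cancelˡ-≡ (+ 4) _ _ (begin
  + 4 ℤ.* (+ 2 ℤ.* + p 2 n)  ≡⟨ sym (ℤ.*-assoc (+ 4) (+ 2) (+ p 2 n)) ⟩
  + 8 ℤ.* + p 2 n            ≡⟨ sym (ℤ.pos-* 8 (p 2 n)) ⟩
  + (8 * p 2 n)              ≡⟨ sym (cong +_ (r₂≡8*p₂ strict)) ⟩
  + r₂ n                     ≡⟨ jacobi n ⟩
  + 4 ℤ.* divisorSumχ₄ n     ∎)
  where open ≡-Reasoning

corollary5p18 : (N : ℕ) →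
    ((+ 2) Data.Integer.* (+ p 2 (16 * N + 10)) ≡ divisorSumχ₄ (16 * N + 10))
    × ((+ 2) Data.Integer.* (+ p 2 (12 * N + 5)) ≡ divisorSumχ₄ (12 * N + 5))
    × ((∃ λ k → N ≡ 2 * k + 1) → 48 * p 3 (8 * N + 6) ≡ r₃ (8 * N + 6))
corollary5p18 N =
  2*p₂≡divisorSumχ₄ (16 * N + 10) {{ℕ.≢-nonZero (ℕ.m+1+n≢0 (16 * N))}}
    (strictReps₂-by-residue 16 (residue 16 N 10) (quadraticFormAvoids-by-decision 16 0 1 10 _) (quadraticFormAvoids-by-decision 16 2 0 10 _)) ,
  2*p₂≡divisorSumχ₄ (12 * N + 5) {{ℕ.≢-nonZero (ℕ.m+1+n≢0 (12 * N))}}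
    (strictReps₂-by-residue 12 (residue 12 N 5) (quadraticFormAvoids-by-decision 12 0 1 5 _) (quadraticFormAvoids-by-decision 12 2 0 5 _)) ,
  λ { (k , refl) → sym (r₃≡48*p₃ (strictReps₃-by-residue 16 {8 * (2 * k + 1) + 6} (trans (cong (ℕ._% 16) (identity k)) (residue 16 k 14))
                                   (quadraticFormAvoids-by-decision 16 1 1 14 _) (quadraticFormAvoids-by-decision 16 2 1 14 _))) }
  where
  residue : ∀ d k r .{{_ : ℕ.NonZero d}} → (d * k + r) ℕ.% d ≡ r ℕ.% d
  residue d k r = trans (cong (ℕ._% d) (trans (ℕ.+-comm (d * k) r) (cong (_+_ r) (ℕ.*-comm d k)))) ([m+kn]%n≡m%n r k d)
  identity : ∀ k → 8 * (2 * k + 1) + 6 ≡ 16 * k + 14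
  identity = solve-∀
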